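{- If $c$ is a positive integer and $n,k$ are positive integers with $n\ge(c+1)k$, then $$a_c(n,k)=\binom{n-k-1}{k}-(c-2)\sum_{j=0}^{k-1}\binom{n-k-1}{j}.$$
   Context: $\Bbbk$ is a field of characteristic $0$; $\mathcal{M}$ is the free monoid on letters $D,U$; $\mathcal{W}=\Bbbk\langle D,U\mid DU-UD=1\rangle$; $\phi:\mathcal{M}\to\mathcal{W}$ is the monoid morphism with $D\mapsto D,U\mapsto U$; words $u,v$ are Weyl-equivalent if $\phi(u)=\phi(v)$. For $c>0$, $\mathcal{M}_c$ is the set of words every prefix of which contains at least $c$ times as many $U$'s as $D$'s. $a_c(n,k)$ is the number of Weyl-equivalence classes that contain a word of $\mathcal{M}_c$ consisting of $k$ letters $D$ and $n-k$ letters $U$. -}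

module Defs where

open import Level using (Level; _⊔_) renaming (suc to lsuc)
open import Data.Nat as ℕ using (ℕ; zero; suc)
open import Data.Nat.Combinatorics using (_C_)
open import Data.Integer as ℤ using (ℤ; +_)
open import Data.List using (List; []; _∷_; _++_; length; concatMap; upTo; map)
open import Data.List.Relation.Unary.All using (All)
open import Data.List.Relation.Unary.Any using (Any)
open import Data.List.Relation.Unary.AllPairs using (AllPairs)
open import Data.Product using (Σ; ∃; _×_; _,_)
open import Relation.Nullary using (¬_; yes; no)
open import Relation.Binary.PropositionalEquality using (_≡_)
open import Algebra.Bundles using (CommutativeRing)

record Field (a ℓ : Level) : Set (lsuc (a ⊔ ℓ)) where
  field
    commRing : CommutativeRing a ℓ
  open CommutativeRing commRing public
  field
    0≉1     : ¬ (0# ≈ 1#)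
    inverse : ∀ x → ¬ (x ≈ 0#) → Σ Carrier (λ y → (x * y) ≈ 1#)

  ι : ℕ → Carrier
  ι zero    = 0#
  ι (suc n) = 1# + ι n

CharZero : ∀ {a ℓ} → Field a ℓ → Set ℓ
CharZero F = ∀ n → ι n ≈ 0# → n ≡ 0
  where open Field F

data Letter : Set where
  D U : Letter

Word : Set
Word = List Letter

_≟L_ : (x y : Letter) → Relation.Nullary.Dec (x ≡ y)
D ≟L D = yes Relation.Binary.PropositionalEquality.refl
D ≟L U = no (λ ())
U ≟L D = no (λ ())
U ≟L U = yes Relation.Binary.PropositionalEquality.refl

_≟W_ : (u v : Word) → Relation.Nullary.Dec (u ≡ v)
_≟W_ = Data.List.Properties.≡-dec _≟L_
  where import Data.List.Properties

#D #U : Word → ℕ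
#D []      = 0
#D (D ∷ w) = suc (#D w)
#D (U ∷ w) = #D w
#U []      = 0
#U (D ∷ w) = #U w
#U (U ∷ w) = suc (#U w)

-- The Weyl algebra W = k⟨D,U⟩ / (DU - UD - 1) and Weyl-equivalence.
-- An element of the free algebra k⟨D,U⟩ is represented by a finite formal
-- linear combination of words; its coefficient at a word w is computed below.
-- phi(u) = phi(v) in W  iff  u - v lies in the two-sided ideal generated by
-- r = DU - UD - 1, i.e. u - v = Σ_i c_i a_i r b_i for some c_i ∈ k and
-- words a_i, b_i.

module _ {a ℓ} (F : Field a ℓ) where
  open Field F

  coeff : List (Carrier × Word) → Word → Carrier
  coeff []             w = 0#
  coeff ((c , x) ∷ xs) w with x ≟W w
  ... | yes _ = c + coeff xs w
  ... | no  _ = coeff xs w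

  idealElem : List (Carrier × Word × Word) → List (Carrier × Word)
  idealElem = concatMap λ { (c , x , y) →
                 (c , x ++ D ∷ U ∷ y) ∷ (- c , x ++ U ∷ D ∷ y) ∷ (- c , x ++ y) ∷ [] }

  WeylEquiv : Word → Word → Set (a ⊔ ℓ)
  WeylEquiv u v = ∃ λ (L : List (Carrier × Word × Word)) →
    ∀ w → coeff ((1# , u) ∷ (- 1# , v) ∷ []) w ≈ coeff (idealElem L) w

InM : ℕ → Word → Set
InM c w = ∀ p s → p ++ s ≡ w → c ℕ.* #D p ℕ.≤ #U p

NumClasses : ∀ {r} (R : Word → Word → Set r) (P : Word → Set) → ℕ → Set r
NumClasses R P N = ∃ λ (reps : List Word) →
  length reps ≡ N × All P reps × AllPairs (λ x y → ¬ R x y) reps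
  × (∀ w → P w → Any (R w) reps)

-- a_c(n,k) = N : the number of Weyl-equivalence classes containing a word of
-- M_c with k letters D and n-k letters U is N.
a-is : ∀ {a ℓ} → Field a ℓ → (c n k N : ℕ) → Set (a ⊔ ℓ)
a-is F c n k N =
  NumClasses (WeylEquiv F) (λ w → InM c w × #D w ≡ k × #U w ≡ n ℕ.∸ k) N

rhs : (c n k : ℕ) → ℤ
rhs c n k = (+ ((n ℕ.∸ k ℕ.∸ 1) C k)) ℤ.- ((+ c ℤ.- + 2) ℤ.* (+ sumC))
  where import Data.Nat.ListAction
        sumC = Data.Nat.ListAction.sum (map (λ j → (n ℕ.∸ k ℕ.∸ 1) C j) (upTo k))

-- Normal ordering rewrites a word w as the sum over j of r_j(w) U^(#U w − j) D^(#D w − j),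
-- where r_j(w) are the rook numbers of the Ferrers board of w.  They depend only on
-- #U w and on the multiset of levels of w (the level of a D is the number of U's before
-- it plus the number of D's after it), because the recursion computing them commutes
-- when two D's are swapped.  Conversely, a product of linear polynomials, one for each
-- D, is compatible with DU = UD + 1, and in characteristic 0 its order of vanishing
-- at 0 is the multiplicity of a prescribed level.  So the Weyl-equivalence classes of
-- words with k letters D and m = n − k letters U are the level multisets.  For words in
-- M_c such a multiset consists of j levels below m, which after a shift form a strictly
-- decreasing ballot sequence (counted by C(N, j) − (c − 1) C(N, j − 1)), and k − j
-- levels filling an interval starting at m (2^(k − j − 1) choices, or 1 if j = k).

module Submission where

open import Defs
open import Data.Nat using (ℕ)

module Words where

  open import Data.Nat using (ℕ; zero; suc; _+_; _*_; _∸_; _<_; _≟_; s≤s)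
  open import Data.Nat.Properties using (*-zeroʳ; m<n⇒m<1+n; ≤-trans; n≤1+n; m≤n⇒m∸n≡0)
  open import Data.List using (List; []; _∷_; _++_; map; replicate; length; filter)
  open import Data.List.Properties using (length-++; filter-++)
  open import Data.List.Relation.Binary.Permutation.Propositional using (_↭_)
  open import Data.List.Relation.Binary.Permutation.Propositional.Properties using (↭-length; filter-↭)
  open import Relation.Binary.PropositionalEquality using (_≡_; refl; cong; trans)

  #U-++ : ∀ x y → #U (x ++ y) ≡ #U x + #U y
  #U-++ []      y = refl
  #U-++ (U ∷ x) y = cong suc (#U-++ x y)
  #U-++ (D ∷ x) y = #U-++ x y

  #D-++ : ∀ x y → #D (x ++ y) ≡ #D x + #D y
  #D-++ []      y = refl
  #D-++ (U ∷ x) y = #D-++ x y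
  #D-++ (D ∷ x) y = cong suc (#D-++ x y)

  U^_D^_ : ℕ → ℕ → Word
  U^ p D^ q = replicate p U ++ replicate q D

  -- The level of an occurrence of D is the number of U's before it plus the
  -- number of D's after it.
  levels : Word → List ℕ
  levels []      = []
  levels (U ∷ w) = map suc (levels w)
  levels (D ∷ w) = #D w ∷ levels w

  multiplicity : ℕ → List ℕ → ℕ
  multiplicity t xs = length (filter (_≟ t) xs)

  multiplicity-↭ : ∀ t {xs ys} → xs ↭ ys → multiplicity t xs ≡ multiplicity t ys
  multiplicity-↭ t p = ↭-length (filter-↭ (_≟ t) p)

  multiplicity-++ : ∀ t xs ys → multiplicity t (xs ++ ys) ≡ multiplicity t xs + multiplicity t ys
  multiplicity-++ t xs ys = trans (cong length (filter-++ (_≟ t) xs ys)) (length-++ (filter (_≟ t) xs))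

  -- rook w j is the coefficient of U^ (#U w ∸ j) D^ (#D w ∸ j) in the normal
  -- ordering of w, i.e. the number of placements of j non-attacking rooks on
  -- the Ferrers board of w.
  rook : Word → ℕ → ℕ
  rook []      zero    = 1
  rook []      (suc j) = 0
  rook (U ∷ w) j       = rook w j
  rook (D ∷ w) zero    = rook w zero
  rook (D ∷ w) (suc j) = rook w (suc j) + (#U w ∸ j) * rook w j

  rook-beyond-#D : ∀ w j → #D w < j → rook w j ≡ 0
  rook-beyond-#D []      (suc j) _       = refl
  rook-beyond-#D (U ∷ w) j       h       = rook-beyond-#D w j h
  rook-beyond-#D (D ∷ w) (suc j) (s≤s h)
    rewrite rook-beyond-#D w (suc j) (m<n⇒m<1+n h) | rook-beyond-#D w j h = *-zeroʳ (#U w ∸ j)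

  rook-beyond-#U : ∀ w j → #U w < j → rook w j ≡ 0
  rook-beyond-#U []      (suc j) _       = refl
  rook-beyond-#U (U ∷ w) j       h       = rook-beyond-#U w j (≤-trans (n≤1+n _) h)
  rook-beyond-#U (D ∷ w) (suc j) (s≤s h)
    rewrite rook-beyond-#U w (suc j) (s≤s h) | m≤n⇒m∸n≡0 h = refl

module Congruence {a ℓ} (F : Field a ℓ) where

  open Field F hiding (zero)
  open import Level using (_⊔_)
  open import Data.List using (List; []; _∷_; _++_; map)
  open import Data.List.Properties using (∷-injectiveˡ; ∷-injectiveʳ)
  open import Data.Product using (_×_; _,_)
  open import Relation.Nullary using (yes; no; contradiction)
  open import Relation.Binary.PropositionalEquality as ≡ using (_≡_; _≢_)
  open import Algebra.Properties.Ring ring using (-1*x≈-x; -‿distribʳ-*)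
  open import Algebra.Properties.AbelianGroup +-abelianGroup using (⁻¹-∙-comm)
  open import Algebra.Properties.CommutativeSemigroup +-commutativeSemigroup using (interchange; x∙yz≈y∙xz)
  open import Relation.Binary.Reasoning.Setoid setoid

  Combination : Set a
  Combination = List (Carrier × Word)

  Relators : Set a
  Relators = List (Carrier × Word × Word)

  cf : Combination → Word → Carrier
  cf = coeff F

  relator : Relators → Combination
  relator = idealElem F

  indicator : Word → Word → Carrier
  indicator x w with x ≟W w
  ... | yes _ = 1#
  ... | no  _ = 0#

  indicator-≡ : ∀ {x w} → x ≡ w → indicator x w ≈ 1#
  indicator-≡ {x} {w} x≡w with x ≟W w
  ... | yes _   = refl
  ... | no  x≢w = contradiction x≡w x≢w

  indicator-≢ : ∀ {x w} → x ≢ w → indicator x w ≈ 0#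
  indicator-≢ {x} {w} x≢w with x ≟W w
  ... | yes x≡w = contradiction x≡w x≢w
  ... | no  _   = refl

  indicator-resp : ∀ {x w x′ w′} → (x ≡ w → x′ ≡ w′) → (x′ ≡ w′ → x ≡ w) → indicator x w ≈ indicator x′ w′
  indicator-resp {x} {w} {x′} {w′} to from with x ≟W w | x′ ≟W w′
  ... | yes _   | yes _   = refl
  ... | no  _   | no  _   = refl
  ... | yes x≡w | no  x≢w = contradiction (to x≡w) x≢w
  ... | no  x≢w | yes x≡w = contradiction (from x≡w) x≢w

  cf-∷ : ∀ c x A w → cf ((c , x) ∷ A) w ≈ c * indicator x w + cf A w
  cf-∷ c x A w with x ≟W w
  ... | yes _ = +-congʳ (sym (*-identityʳ c))
  ... | no  _ = sym (trans (+-congʳ (zeroʳ c)) (+-identityˡ _))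

  cf-[_] : ∀ {c} x w → cf ((c , x) ∷ []) w ≈ c * indicator x w
  cf-[_] {c} x w = trans (cf-∷ c x [] w) (+-identityʳ _)

  cf-++ : ∀ A B w → cf (A ++ B) w ≈ cf A w + cf B w
  cf-++ []              B w = sym (+-identityˡ _)
  cf-++ ((c , x) ∷ A) B w = begin
    cf ((c , x) ∷ (A ++ B)) w         ≈⟨ cf-∷ c x (A ++ B) w ⟩
    c * indicator x w + cf (A ++ B) w ≈⟨ +-congˡ (cf-++ A B w) ⟩
    c * indicator x w + (cf A w + cf B w) ≈⟨ +-assoc _ _ _ ⟨
    (c * indicator x w + cf A w) + cf B w ≈⟨ +-congʳ (cf-∷ c x A w) ⟨
    cf ((c , x) ∷ A) w + cf B w       ∎

  cf-relator-∷ : ∀ c x y L w → cf (relator ((c , x , y) ∷ L)) w ≈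
    c * indicator (x ++ D ∷ U ∷ y) w + (- c * indicator (x ++ U ∷ D ∷ y) w + (- c * indicator (x ++ y) w + cf (relator L) w))
  cf-relator-∷ c x y L w =
    trans (cf-∷ c (x ++ D ∷ U ∷ y) _ w)
        (+-congˡ (trans (cf-∷ (- c) (x ++ U ∷ D ∷ y) _ w) (+-congˡ (cf-∷ (- c) (x ++ y) (relator L) w))))

  relator-++ : ∀ L L′ → relator (L ++ L′) ≡ relator L ++ relator L′
  relator-++ []                L′ = ≡.refl
  relator-++ ((c , x , y) ∷ L) L′ = ≡.cong (λ R → _ ∷ _ ∷ _ ∷ R) (relator-++ L L′)

  cf-relator-++ : ∀ L L′ w → cf (relator (L ++ L′)) w ≈ cf (relator L) w + cf (relator L′) w
  cf-relator-++ L L′ w = trans (reflexive (≡.cong (λ R → cf R w) (relator-++ L L′))) (cf-++ (relator L) _ w)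

  record _∼_ (A B : Combination) : Set (a ⊔ ℓ) where
    constructor _,_
    field
      relators : Relators
      cf-eq    : ∀ w → cf A w ≈ cf B w + cf (relator relators) w

  ∼-pointwise : ∀ {A B} → (∀ w → cf A w ≈ cf B w) → A ∼ B
  ∼-pointwise A≈B = [] , λ w → trans (A≈B w) (sym (+-identityʳ _))

  ∼-refl : ∀ {A} → A ∼ A
  ∼-refl = ∼-pointwise (λ _ → refl)

  ∼-reflexive : ∀ {A B} → A ≡ B → A ∼ B
  ∼-reflexive ≡.refl = ∼-refl

  ∼-trans : ∀ {A B C} → A ∼ B → B ∼ C → A ∼ C
  ∼-trans {A} {B} {C} (L , A∼B) (L′ , B∼C) = L′ ++ L , λ w → begin
    cf A w                                         ≈⟨ A∼B w ⟩
    cf B w + cf (relator L) w                      ≈⟨ +-congʳ (B∼C w) ⟩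
    (cf C w + cf (relator L′) w) + cf (relator L) w ≈⟨ +-assoc _ _ _ ⟩
    cf C w + (cf (relator L′) w + cf (relator L) w) ≈⟨ +-congˡ (cf-relator-++ L′ L w) ⟨
    cf C w + cf (relator (L′ ++ L)) w              ∎

  ∼-++ : ∀ {A B A′ B′} → A ∼ B → A′ ∼ B′ → (A ++ A′) ∼ (B ++ B′)
  ∼-++ {A} {B} {A′} {B′} (L , A∼B) (L′ , A′∼B′) = L ++ L′ , λ w → begin
    cf (A ++ A′) w     ≈⟨ cf-++ A A′ w ⟩
    cf A w + cf A′ w   ≈⟨ +-cong (A∼B w) (A′∼B′ w) ⟩
    (cf B w + cf (relator L) w) + (cf B′ w + cf (relator L′) w) ≈⟨ interchange _ _ _ _ ⟩
    (cf B w + cf B′ w) + (cf (relator L) w + cf (relator L′) w) ≈⟨ +-cong (cf-++ B B′ w) (cf-relator-++ L L′ w) ⟨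
    cf (B ++ B′) w + cf (relator (L ++ L′)) w ∎

  scale : Carrier → Combination → Combination
  scale r = map (λ (c , x) → (r * c , x))

  scaleRelators : Carrier → Relators → Relators
  scaleRelators r = map (λ (c , x , y) → (r * c , x , y))

  cf-scale : ∀ r A w → cf (scale r A) w ≈ r * cf A w
  cf-scale r []            w = sym (zeroʳ r)
  cf-scale r ((c , x) ∷ A) w = begin
    cf ((r * c , x) ∷ scale r A) w            ≈⟨ cf-∷ (r * c) x (scale r A) w ⟩
    r * c * indicator x w + cf (scale r A) w  ≈⟨ +-cong (*-assoc _ _ _) (cf-scale r A w) ⟩
    r * (c * indicator x w) + r * cf A w      ≈⟨ distribˡ r _ _ ⟨
    r * (c * indicator x w + cf A w)          ≈⟨ *-congˡ (cf-∷ c x A w) ⟨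
    r * cf ((c , x) ∷ A) w                    ∎

  cf-relator-scale : ∀ r L w → cf (relator (scaleRelators r L)) w ≈ r * cf (relator L) w
  cf-relator-scale r []                w = sym (zeroʳ r)
  cf-relator-scale r ((c , x , y) ∷ L) w = begin
    cf (relator ((r * c , x , y) ∷ scaleRelators r L)) w
      ≈⟨ cf-relator-∷ (r * c) x y (scaleRelators r L) w ⟩
    r * c * δ₁ + (- (r * c) * δ₂ + (- (r * c) * δ₃ + cf (relator (scaleRelators r L)) w))
      ≈⟨ +-cong (*-assoc _ _ _) (+-cong (neg-scale δ₂) (+-cong (neg-scale δ₃) (cf-relator-scale r L w))) ⟩
    r * (c * δ₁) + (r * (- c * δ₂) + (r * (- c * δ₃) + r * cf (relator L) w))
      ≈⟨ +-congˡ (+-congˡ (distribˡ r _ _)) ⟨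
    r * (c * δ₁) + (r * (- c * δ₂) + r * (- c * δ₃ + cf (relator L) w))
      ≈⟨ +-congˡ (distribˡ r _ _) ⟨
    r * (c * δ₁) + r * (- c * δ₂ + (- c * δ₃ + cf (relator L) w))
      ≈⟨ distribˡ r _ _ ⟨
    r * (c * δ₁ + (- c * δ₂ + (- c * δ₃ + cf (relator L) w)))
      ≈⟨ *-congˡ (cf-relator-∷ c x y L w) ⟨
    r * cf (relator ((c , x , y) ∷ L)) w ∎
    where
    δ₁ = indicator (x ++ D ∷ U ∷ y) w
    δ₂ = indicator (x ++ U ∷ D ∷ y) w
    δ₃ = indicator (x ++ y) w
    neg-scale : ∀ d → - (r * c) * d ≈ r * (- c * d)
    neg-scale d = trans (*-congʳ (-‿distribʳ-* r c)) (*-assoc _ _ _)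

  ∼-scale : ∀ r {A B} → A ∼ B → scale r A ∼ scale r B
  ∼-scale r {A} {B} (L , A∼B) = scaleRelators r L , λ w → begin
    cf (scale r A) w                     ≈⟨ cf-scale r A w ⟩
    r * cf A w                           ≈⟨ *-congˡ (A∼B w) ⟩
    r * (cf B w + cf (relator L) w)      ≈⟨ distribˡ r _ _ ⟩
    r * cf B w + r * cf (relator L) w    ≈⟨ +-cong (cf-scale r B w) (cf-relator-scale r L w) ⟨
    cf (scale r B) w + cf (relator (scaleRelators r L)) w ∎

  ∼-sym : ∀ {A B} → A ∼ B → B ∼ A
  ∼-sym {A} {B} (L , A∼B) = scaleRelators (- 1#) L , λ w → begin
    cf B w                                       ≈⟨ +-identityʳ _ ⟨
    cf B w + 0#                                  ≈⟨ +-congˡ (-‿inverseʳ _) ⟨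
    cf B w + (cf (relator L) w + - cf (relator L) w) ≈⟨ +-assoc _ _ _ ⟨
    (cf B w + cf (relator L) w) + - cf (relator L) w ≈⟨ +-cong (A∼B w) (-1*x≈-x _) ⟨
    cf A w + - 1# * cf (relator L) w             ≈⟨ +-congˡ (cf-relator-scale (- 1#) L w) ⟨
    cf A w + cf (relator (scaleRelators (- 1#) L)) w ∎

  prefix : Letter → Combination → Combination
  prefix l = map (λ (c , x) → (c , l ∷ x))

  prefixRelators : Letter → Relators → Relators
  prefixRelators l = map (λ (c , x , y) → (c , l ∷ x , y))

  relator-prefix : ∀ l L → relator (prefixRelators l L) ≡ prefix l (relator L)
  relator-prefix l []                = ≡.refl
  relator-prefix l ((c , x , y) ∷ L) = ≡.cong (λ R → _ ∷ _ ∷ _ ∷ R) (relator-prefix l L)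

  cf-prefix-∷ : ∀ l A w → cf (prefix l A) (l ∷ w) ≈ cf A w
  cf-prefix-∷ l []            w = refl
  cf-prefix-∷ l ((c , x) ∷ A) w = begin
    cf ((c , l ∷ x) ∷ prefix l A) (l ∷ w)                   ≈⟨ cf-∷ c (l ∷ x) (prefix l A) (l ∷ w) ⟩
    c * indicator (l ∷ x) (l ∷ w) + cf (prefix l A) (l ∷ w)
      ≈⟨ +-cong (*-congˡ (indicator-resp ∷-injectiveʳ (≡.cong (l ∷_)))) (cf-prefix-∷ l A w) ⟩
    c * indicator x w + cf A w                              ≈⟨ cf-∷ c x A w ⟨
    cf ((c , x) ∷ A) w                                      ∎

  cf-prefix-other : ∀ l A w → (∀ x → l ∷ x ≢ w) → cf (prefix l A) w ≈ 0#
  cf-prefix-other l []            w _   = refl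
  cf-prefix-other l ((c , x) ∷ A) w l∉ = begin
    cf ((c , l ∷ x) ∷ prefix l A) w               ≈⟨ cf-∷ c (l ∷ x) _ w ⟩
    c * indicator (l ∷ x) w + cf (prefix l A) w   ≈⟨ +-cong (*-congˡ (indicator-≢ (l∉ x))) (cf-prefix-other l A w l∉) ⟩
    c * 0# + 0#                                   ≈⟨ +-identityʳ _ ⟩
    c * 0#                                        ≈⟨ zeroʳ c ⟩
    0#                                            ∎

  ∼-prefix : ∀ l {A B} → A ∼ B → prefix l A ∼ prefix l B
  ∼-prefix l {A} {B} (L , A∼B) = prefixRelators l L , cf-eq
    where
    cf-relators : ∀ w → cf (relator (prefixRelators l L)) w ≈ cf (prefix l (relator L)) w
    cf-relators w = reflexive (≡.cong (λ R → cf R w) (relator-prefix l L))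
    vanish : ∀ {w} → (∀ x → l ∷ x ≢ w) → cf (prefix l A) w ≈ cf (prefix l B) w + cf (relator (prefixRelators l L)) w
    vanish {w} l∉ = begin
      cf (prefix l A) w  ≈⟨ cf-prefix-other l A w l∉ ⟩
      0#                 ≈⟨ +-identityʳ 0# ⟨
      0# + 0#            ≈⟨ +-cong (cf-prefix-other l B w l∉) (trans (cf-relators w) (cf-prefix-other l (relator L) w l∉)) ⟨
      cf (prefix l B) w + cf (relator (prefixRelators l L)) w ∎
    cf-eq : ∀ w → cf (prefix l A) w ≈ cf (prefix l B) w + cf (relator (prefixRelators l L)) w
    cf-eq (l′ ∷ w) with l ≟L l′
    ... | yes ≡.refl = begin
      cf (prefix l A) (l ∷ w)                                ≈⟨ cf-prefix-∷ l A w ⟩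
      cf A w                                                 ≈⟨ A∼B w ⟩
      cf B w + cf (relator L) w
        ≈⟨ +-cong (cf-prefix-∷ l B w) (trans (cf-relators (l ∷ w)) (cf-prefix-∷ l (relator L) w)) ⟨
      cf (prefix l B) (l ∷ w) + cf (relator (prefixRelators l L)) (l ∷ w) ∎
    ... | no l≢l′ = vanish (λ x e → l≢l′ (∷-injectiveˡ e))
    cf-eq [] = vanish (λ x ())

  ∼-DU : ∀ y → ((1# , D ∷ U ∷ y) ∷ []) ∼ ((1# , U ∷ D ∷ y) ∷ (1# , y) ∷ [])
  ∼-DU y = ((1# , [] , y) ∷ []) , λ w →
    let a = indicator (D ∷ U ∷ y) w; b = indicator (U ∷ D ∷ y) w; c = indicator y w in begin
    cf ((1# , D ∷ U ∷ y) ∷ []) w  ≈⟨ trans (cf-[ D ∷ U ∷ y ] w) (*-identityˡ a) ⟩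
    a                             ≈⟨ +-identityʳ a ⟨
    a + 0#                        ≈⟨ +-congˡ (-‿inverseʳ (b + c)) ⟨
    a + ((b + c) + - (b + c))     ≈⟨ x∙yz≈y∙xz a (b + c) _ ⟩
    (b + c) + (a + - (b + c))     ≈⟨ +-cong (+-cong (*-identityˡ b) (trans (cf-[ y ] w) (*-identityˡ c)))
                                            (+-cong (*-identityˡ a) (trans (+-cong (-1*x≈-x b)
                                                (trans (+-identityʳ _) (-1*x≈-x c))) (⁻¹-∙-comm b c))) ⟨
    (1# * b + cf ((1# , y) ∷ []) w) + (1# * a + (- 1# * b + (- 1# * c + 0#)))
      ≈⟨ +-cong (cf-∷ 1# (U ∷ D ∷ y) _ w) (cf-relator-∷ 1# [] y [] w) ⟨
    cf ((1# , U ∷ D ∷ y) ∷ (1# , y) ∷ []) w + cf (relator ((1# , [] , y) ∷ [])) w ∎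

  ∼⇒WeylEquiv : ∀ u v → ((1# , u) ∷ []) ∼ ((1# , v) ∷ []) → WeylEquiv F u v
  ∼⇒WeylEquiv u v (L , u∼v) = L , cf-eq
    where
    cf-eq : ∀ w → cf ((1# , u) ∷ (- 1# , v) ∷ []) w ≈ cf (relator L) w
    cf-eq w = begin
      cf ((1# , u) ∷ (- 1# , v) ∷ []) w           ≈⟨ cf-∷ 1# u _ w ⟩
      1# * indicator u w + cf ((- 1# , v) ∷ []) w ≈⟨ +-cong (sym (cf-[ u ] w)) (cf-[ v ] w) ⟩
      cf ((1# , u) ∷ []) w + - 1# * δᵥ            ≈⟨ +-cong (u∼v w) (-1*x≈-x _) ⟩
      (cf ((1# , v) ∷ []) w + r) + - δᵥ           ≈⟨ +-congʳ (+-congʳ (trans (cf-[ v ] w) (*-identityˡ _))) ⟩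
      (δᵥ + r) + - δᵥ                             ≈⟨ +-congʳ (+-comm δᵥ r) ⟩
      (r + δᵥ) + - δᵥ                             ≈⟨ +-assoc _ _ _ ⟩
      r + (δᵥ + - δᵥ)                             ≈⟨ +-congˡ (-‿inverseʳ δᵥ) ⟩
      r + 0#                                      ≈⟨ +-identityʳ r ⟩
      r                                           ∎
      where
      δᵥ = indicator v w
      r = cf (relator L) w

module NormalOrdering {a ℓ} (F : Field a ℓ) where

  open Field F hiding (zero)
  open Words
  open Congruence F
  open import Data.Nat as ℕ using (ℕ; zero; suc; _∸_; pred)
  open import Data.Nat.Properties using (_≤?_; ≰⇒>; +-∸-assoc; n<1+n; pred[m∸n]≡m∸[1+n])
  open import Data.List using ([]; _∷_; _++_; applyUpTo)
  open import Data.List.Properties using (map-applyUpTo; applyUpTo-∷ʳ)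
  open import Data.Product using (_×_; _,_; proj₁; proj₂)
  open import Function using (_∘_)
  open import Relation.Nullary using (yes; no)
  open import Relation.Binary.PropositionalEquality as ≡ using (_≡_)
  open import Algebra.Properties.CommutativeSemigroup +-commutativeSemigroup using (x∙yz≈y∙xz)
  open import Relation.Binary.Reasoning.Setoid setoid

  ι-+ : ∀ m n → ι (m ℕ.+ n) ≈ ι m + ι n
  ι-+ zero    n = sym (+-identityˡ _)
  ι-+ (suc m) n = trans (+-congˡ (ι-+ m n)) (sym (+-assoc _ _ _))

  ι-* : ∀ m n → ι (m ℕ.* n) ≈ ι m * ι n
  ι-* zero    n = sym (zeroˡ _)
  ι-* (suc m) n = begin
    ι (n ℕ.+ m ℕ.* n)       ≈⟨ ι-+ n (m ℕ.* n) ⟩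
    ι n + ι (m ℕ.* n)       ≈⟨ +-cong (*-identityˡ _) (sym (ι-* m n)) ⟨
    1# * ι n + ι m * ι n    ≈⟨ distribʳ _ _ _ ⟨
    (1# + ι m) * ι n        ∎

  Term : Set a
  Term = Carrier × Word

  cf-zero-∷ : ∀ {c} x A w → c ≈ 0# → cf ((c , x) ∷ A) w ≈ cf A w
  cf-zero-∷ {c} x A w c≈0 = trans (cf-∷ c x A w) (trans (+-congʳ (trans (*-congʳ c≈0) (zeroˡ _))) (+-identityˡ _))

  cf-∷-cong : ∀ e A B w → cf A w ≈ cf B w → cf (e ∷ A) w ≈ cf (e ∷ B) w
  cf-∷-cong (c , x) A B w A≈B = trans (cf-∷ c x A w) (trans (+-congˡ A≈B) (sym (cf-∷ c x B w)))

  cf-coeff-cong : ∀ {c d} x A w → c ≈ d → cf ((c , x) ∷ A) w ≈ cf ((d , x) ∷ A) w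
  cf-coeff-cong {c} {d} x A w c≈d = trans (cf-∷ c x A w) (trans (+-congʳ (*-congʳ c≈d)) (sym (cf-∷ d x A w)))

  cf-merge : ∀ c d x A w → cf ((c , x) ∷ (d , x) ∷ A) w ≈ cf ((c + d , x) ∷ A) w
  cf-merge c d x A w = begin
    cf ((c , x) ∷ (d , x) ∷ A) w          ≈⟨ trans (cf-∷ c x _ w) (+-congˡ (cf-∷ d x A w)) ⟩
    c * δ + (d * δ + cf A w)              ≈⟨ +-assoc _ _ _ ⟨
    (c * δ + d * δ) + cf A w              ≈⟨ +-congʳ (distribʳ δ c d) ⟨
    (c + d) * δ + cf A w                  ≈⟨ cf-∷ (c + d) x A w ⟨
    cf ((c + d , x) ∷ A) w                ∎
    where δ = indicator x w

  ∼-applyUpTo : ∀ n (f g : ℕ → Term) → (∀ j → (f j ∷ []) ∼ (g j ∷ [])) → applyUpTo f n ∼ applyUpTo g n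
  ∼-applyUpTo zero    f g f∼g = ∼-refl
  ∼-applyUpTo (suc n) f g f∼g = ∼-++ (f∼g 0) (∼-applyUpTo n (f ∘ suc) (g ∘ suc) (f∼g ∘ suc))

  ∼-applyUpTo-split : ∀ n (f g h : ℕ → Term) → (∀ j → (f j ∷ []) ∼ (g j ∷ h j ∷ [])) →
                      applyUpTo f n ∼ (applyUpTo g n ++ applyUpTo h n)
  ∼-applyUpTo-split zero    f g h f∼g+h = ∼-refl
  ∼-applyUpTo-split (suc n) f g h f∼g+h =
    ∼-trans (∼-++ (f∼g+h 0) (∼-applyUpTo-split n (f ∘ suc) (g ∘ suc) (h ∘ suc) (f∼g+h ∘ suc))) (∼-pointwise interleave)
    where
    G = applyUpTo (g ∘ suc) n
    H = applyUpTo (h ∘ suc) n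
    interleave : ∀ w → cf (g 0 ∷ h 0 ∷ (G ++ H)) w ≈ cf (g 0 ∷ (G ++ h 0 ∷ H)) w
    interleave w = begin
      cf (g 0 ∷ h 0 ∷ (G ++ H)) w                     ≈⟨ cf-++ (g 0 ∷ []) _ w ⟩
      cf (g 0 ∷ []) w + cf (h 0 ∷ (G ++ H)) w         ≈⟨ +-congˡ (trans (cf-++ (h 0 ∷ []) _ w) (+-congˡ (cf-++ G H w))) ⟩
      cf (g 0 ∷ []) w + (cf (h 0 ∷ []) w + (cf G w + cf H w)) ≈⟨ +-congˡ (x∙yz≈y∙xz _ _ _) ⟩
      cf (g 0 ∷ []) w + (cf G w + (cf (h 0 ∷ []) w + cf H w))
        ≈⟨ +-congˡ (trans (cf-++ G _ w) (+-congˡ (cf-++ (h 0 ∷ []) H w))) ⟨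
      cf (g 0 ∷ []) w + cf (G ++ h 0 ∷ H) w           ≈⟨ cf-++ (g 0 ∷ []) _ w ⟨
      cf (g 0 ∷ (G ++ h 0 ∷ H)) w                     ∎


  ∼-applyUpTo-dropLast : ∀ n (f : ℕ → Term) → proj₁ (f n) ≈ 0# → applyUpTo f (suc n) ∼ applyUpTo f n
  ∼-applyUpTo-dropLast n f fn≈0 = ∼-trans (∼-reflexive (≡.sym (applyUpTo-∷ʳ f n))) (∼-pointwise λ w → begin
    cf (applyUpTo f n ++ f n ∷ []) w          ≈⟨ cf-++ (applyUpTo f n) _ w ⟩
    cf (applyUpTo f n) w + cf (f n ∷ []) w    ≈⟨ +-congˡ (cf-zero-∷ (proj₂ (f n)) [] w fn≈0) ⟩
    cf (applyUpTo f n) w + 0#                 ≈⟨ +-identityʳ _ ⟩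
    cf (applyUpTo f n) w                      ∎)

  D·U^pD^q : ∀ p q → ((1# , D ∷ U^ p D^ q) ∷ []) ∼ ((1# , U^ p D^ (suc q)) ∷ (ι p , U^ pred p D^ q) ∷ [])
  D·U^pD^q zero    q = ∼-pointwise λ w → cf-∷-cong (1# , U^ 0 D^ suc q) [] ((ι 0 , U^ 0 D^ q) ∷ []) w
      (sym (cf-zero-∷ (U^ 0 D^ q) [] w refl))
  D·U^pD^q (suc p) q =
    ∼-trans (∼-DU (U^ p D^ q)) (∼-trans (∼-++ (∼-prefix U (D·U^pD^q p q)) ∼-refl) (∼-pointwise (collect p)))
    where
    collect : ∀ p w → cf ((1# , U^ suc p D^ suc q) ∷ (ι p , U ∷ U^ pred p D^ q) ∷ (1# , U^ p D^ q) ∷ []) w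
                    ≈ cf ((1# , U^ suc p D^ suc q) ∷ (ι (suc p) , U^ p D^ q) ∷ []) w
    collect zero    w = cf-∷-cong (1# , U^ 1 D^ suc q) ((ι 0 , U ∷ U^ 0 D^ q) ∷ (1# , U^ 0 D^ q) ∷ [])
        ((ι 1 , U^ 0 D^ q) ∷ []) w
      (trans (cf-zero-∷ (U ∷ U^ 0 D^ q) _ w refl) (cf-coeff-cong (U^ 0 D^ q) [] w (sym (+-identityʳ 1#))))
    collect (suc p) w = cf-∷-cong (1# , U^ suc (suc p) D^ suc q) ((ι (suc p) , U ∷ U^ p D^ q) ∷ (1# , U^ suc p D^ q) ∷ [])
                                  ((ι (suc (suc p)) , U^ suc p D^ q) ∷ []) w
      (trans (cf-merge (ι (suc p)) 1# (U^ suc p D^ q) [] w) (cf-coeff-cong (U^ suc p D^ q) [] w (+-comm _ _)))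

  term : Word → ℕ → Term
  term w j = (ι (rook w j) , U^ (#U w ∸ j) D^ (#D w ∸ j))

  normalForm : Word → Combination
  normalForm w = applyUpTo (term w) (suc (#D w))

  normalForm-U : ∀ w → prefix U (normalForm w) ∼ normalForm (U ∷ w)
  normalForm-U w = ∼-trans (∼-reflexive (map-applyUpTo (term w) _ (suc (#D w))))
                           (∼-applyUpTo (suc (#D w)) (λ j → (ι (rook w j) , U ∷ U^ (#U w ∸ j) D^ (#D w ∸ j))) (term (U ∷ w))
                                        (λ j → ∼-pointwise (prefix-term j)))
    where
    prefix-term : ∀ j w′ → cf ((ι (rook w j) , U ∷ U^ (#U w ∸ j) D^ (#D w ∸ j)) ∷ []) w′ ≈ cf (term (U ∷ w) j ∷ []) w′
    prefix-term j w′ with j ≤? #U w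
    ... | yes j≤p rewrite +-∸-assoc 1 j≤p = refl
    ... | no  j≰p rewrite rook-beyond-#U w j (≰⇒> j≰p) =
      trans (cf-zero-∷ (U ∷ U^ (#U w ∸ j) D^ (#D w ∸ j)) [] w′ refl)
          (sym (cf-zero-∷ (U^ (suc (#U w) ∸ j) D^ (#D w ∸ j)) [] w′ refl))

  -- Moving D to the right through every term; the coefficient 0 terms at
  -- the two ends make both sides sums over the same range of indices.
  normalForm-D : ∀ w → prefix D (normalForm w) ∼ normalForm (D ∷ w)
  normalForm-D w = ∼-trans passD (∼-trans (∼-++ reindexX reindexY) (∼-sym recombine))
    where
    p = #U w
    q = #D w
    r = rook w
    X Y X′ Y′ : ℕ → Term
    X j = (ι (r j) * 1# , U^ (p ∸ j) D^ suc (q ∸ j))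
    Y j = (ι (r j) * ι (p ∸ j) , U^ pred (p ∸ j) D^ (q ∸ j))
    X′ j = (ι (r j) , U^ (p ∸ j) D^ (suc q ∸ j))
    Y′ zero    = (0# , U^ p D^ suc q)
    Y′ (suc j) = (ι (p ∸ j) * ι (r j) , U^ (p ∸ suc j) D^ (q ∸ j))

    passD : prefix D (normalForm w) ∼ (applyUpTo X (suc q) ++ applyUpTo Y (suc q))
    passD = ∼-trans (∼-reflexive (map-applyUpTo (term w) _ (suc q)))
        (∼-applyUpTo-split (suc q) (λ j → (ι (r j) , D ∷ U^ (p ∸ j) D^ (q ∸ j))) X Y λ j →
      ∼-trans (∼-pointwise (λ w′ → cf-coeff-cong (D ∷ U^ (p ∸ j) D^ (q ∸ j)) [] w′ (sym (*-identityʳ _))))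
              (∼-scale (ι (r j)) (D·U^pD^q (p ∸ j) (q ∸ j))))

    X∼X′ : ∀ j w′ → cf (X j ∷ []) w′ ≈ cf (X′ j ∷ []) w′
    X∼X′ j w′ with j ≤? q
    ... | yes j≤q rewrite +-∸-assoc 1 j≤q = cf-coeff-cong (U^ (p ∸ j) D^ suc (q ∸ j)) [] w′ (*-identityʳ _)
    ... | no  j≰q rewrite rook-beyond-#D w j (≰⇒> j≰q) =
      trans (cf-zero-∷ (U^ (p ∸ j) D^ suc (q ∸ j)) [] w′ (zeroˡ _)) (sym (cf-zero-∷ (U^ (p ∸ j) D^ (suc q ∸ j)) [] w′ refl))

    reindexX : applyUpTo X (suc q) ∼ applyUpTo X′ (suc (suc q))
    reindexX = ∼-trans (∼-applyUpTo (suc q) X X′ (λ j → ∼-pointwise (X∼X′ j)))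
      (∼-sym (∼-applyUpTo-dropLast (suc q) X′ (reflexive (≡.cong ι (rook-beyond-#D w (suc q) (n<1+n q))))))

    Y∼Y′ : ∀ j w′ → cf (Y j ∷ []) w′ ≈ cf (Y′ (suc j) ∷ []) w′
    Y∼Y′ j w′ rewrite pred[m∸n]≡m∸[1+n] p j = cf-coeff-cong (U^ (p ∸ suc j) D^ (q ∸ j)) [] w′ (*-comm _ _)

    reindexY : applyUpTo Y (suc q) ∼ applyUpTo Y′ (suc (suc q))
    reindexY = ∼-trans (∼-applyUpTo (suc q) Y (Y′ ∘ suc) (λ j → ∼-pointwise (Y∼Y′ j)))
                       (∼-pointwise (λ w′ → sym (cf-zero-∷ (U^ p D^ suc q) (applyUpTo (Y′ ∘ suc) (suc q)) w′ refl)))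

    rook-step : ∀ j w′ → cf (term (D ∷ w) j ∷ []) w′ ≈ cf (X′ j ∷ Y′ j ∷ []) w′
    rook-step zero    w′ = cf-∷-cong (X′ 0) [] (Y′ 0 ∷ []) w′ (sym (cf-zero-∷ (U^ p D^ suc q) [] w′ refl))
    rook-step (suc j) w′ = begin
      cf (term (D ∷ w) (suc j) ∷ []) w′
        ≈⟨ cf-coeff-cong (U^ (p ∸ suc j) D^ (q ∸ j)) [] w′
          (trans (ι-+ (r (suc j)) _) (+-congˡ (trans (ι-* (p ∸ j) (r j)) (*-comm _ _)))) ⟩
      cf ((ι (r (suc j)) + ι (r j) * ι (p ∸ j) , U^ (p ∸ suc j) D^ (q ∸ j)) ∷ []) w′
        ≈⟨ cf-coeff-cong (U^ (p ∸ suc j) D^ (q ∸ j)) [] w′ (+-congˡ (*-comm _ _)) ⟩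
      cf ((ι (r (suc j)) + ι (p ∸ j) * ι (r j) , U^ (p ∸ suc j) D^ (q ∸ j)) ∷ []) w′
        ≈⟨ cf-merge (ι (r (suc j))) (ι (p ∸ j) * ι (r j)) (U^ (p ∸ suc j) D^ (q ∸ j)) [] w′ ⟨
      cf (X′ (suc j) ∷ Y′ (suc j) ∷ []) w′ ∎

    recombine : normalForm (D ∷ w) ∼ (applyUpTo X′ (suc (suc q)) ++ applyUpTo Y′ (suc (suc q)))
    recombine = ∼-applyUpTo-split (suc (suc q)) (term (D ∷ w)) X′ Y′ (λ j → ∼-pointwise (rook-step j))

  ∼-normalForm : ∀ w → ((1# , w) ∷ []) ∼ normalForm w
  ∼-normalForm []      = ∼-pointwise λ w′ → cf-coeff-cong [] [] w′ (sym (+-identityʳ 1#))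
  ∼-normalForm (U ∷ w) = ∼-trans (∼-prefix U (∼-normalForm w)) (normalForm-U w)
  ∼-normalForm (D ∷ w) = ∼-trans (∼-prefix D (∼-normalForm w)) (normalForm-D w)

  weylEquiv-rook : ∀ u v → #U u ≡ #U v → #D u ≡ #D v → (∀ j → rook u j ≡ rook v j) → WeylEquiv F u v
  weylEquiv-rook u v #Uu≡#Uv #Du≡#Dv ru≡rv =
    ∼⇒WeylEquiv u v (∼-trans (∼-normalForm u) (∼-trans normalForms (∼-sym (∼-normalForm v))))
    where
    term-≡ : ∀ j → term u j ≡ term v j
    term-≡ j = ≡.cong₂ _,_ (≡.cong ι (ru≡rv j)) (≡.cong₂ (λ x y → U^ (x ∸ j) D^ (y ∸ j)) #Uu≡#Uv #Du≡#Dv)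
    normalForms : normalForm u ∼ normalForm v
    normalForms = ∼-trans (∼-applyUpTo (suc (#D u)) (term u) (term v) (λ j → ∼-reflexive (≡.cong (_∷ []) (term-≡ j))))
                          (∼-reflexive (≡.cong (λ n → applyUpTo (term v) (suc n)) #Du≡#Dv))

module RookSymmetry where

  open Words
  open import Data.Nat as ℕ using (ℕ; zero; suc; _∸_)
  open import Data.Nat.Properties using (_≤?_; ≰⇒>)
  open import Data.Integer using (ℤ; +_; _+_; _*_; _-_)
  open import Data.Integer.Properties using (pos-*; ⊖-≥; m-n≡m⊖n; [1+m]⊖[1+n]≡m⊖n; +-injective; *-zeroʳ)
  open import Data.Integer.Tactic.RingSolver using (solve-∀)
  open import Data.List using (List; []; _∷_; length; map)
  open import Data.List.Properties using (map-∘; map-cong)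
  open import Data.List.Relation.Binary.Permutation.Propositional using (_↭_; refl; prep; swap; trans)
  open import Data.List.Relation.Binary.Permutation.Propositional.Properties using (↭-length; map⁺)
  open import Relation.Nullary using (yes; no)
  open import Relation.Binary.PropositionalEquality as ≡ using (_≡_; cong; cong₂; sym)
  open ≡.≡-Reasoning

  -- The effect on rook numbers of a new leftmost D with d D's after it and
  -- s = (#U − #D) of the word after it: that D sees s + d U's.
  step : ℤ → ℕ → (ℕ → ℤ) → ℕ → ℤ
  step s d f zero    = f zero
  step s d f (suc j) = f (suc j) + (s + + d - + j) * f j

  rookℤ : List ℤ → ℕ → ℤ
  rookℤ []       zero    = + 1
  rookℤ []       (suc j) = + 0
  rookℤ (s ∷ ss) j       = step s (length ss) (rookℤ ss) j

  step-cong : ∀ s d {f g} → (∀ j → f j ≡ g j) → ∀ j → step s d f j ≡ step s d g j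
  step-cong s d f≡g zero    = f≡g zero
  step-cong s d f≡g (suc j) = cong₂ (λ a b → a + (s + + d - + j) * b) (f≡g (suc j)) (f≡g j)

  step-comm : ∀ x y d f j → step x (suc d) (step y d f) j ≡ step y (suc d) (step x d f) j
  step-comm x y d f zero          = ≡.refl
  step-comm x y d f (suc zero)    = comm₁ x y (+ d) (f 0) (f 1)
    where
    comm₁ : ∀ x y d f₀ f₁ → (f₁ + (y + d - + 0) * f₀) + (x + (+ 1 + d) - + 0) * f₀
                          ≡ (f₁ + (x + d - + 0) * f₀) + (y + (+ 1 + d) - + 0) * f₀
    comm₁ = solve-∀
  step-comm x y d f (suc (suc j)) = comm₂ x y (+ d) (+ j) (f j) (f (suc j)) (f (suc (suc j)))
    where
    comm₂ : ∀ x y d j f₀ f₁ f₂ →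
      (f₂ + (y + d - (+ 1 + j)) * f₁) + (x + (+ 1 + d) - (+ 1 + j)) * (f₁ + (y + d - j) * f₀) ≡
      (f₂ + (x + d - (+ 1 + j)) * f₁) + (y + (+ 1 + d) - (+ 1 + j)) * (f₁ + (x + d - j) * f₀)
    comm₂ = solve-∀

  rookℤ-↭ : ∀ {xs ys} → xs ↭ ys → ∀ j → rookℤ xs j ≡ rookℤ ys j
  rookℤ-↭ refl j = ≡.refl
  rookℤ-↭ {x ∷ xs} {x ∷ ys} (prep x p) j rewrite ↭-length p = step-cong x (length ys) (rookℤ-↭ p) j
  rookℤ-↭ {x ∷ y ∷ xs} {y ∷ x ∷ ys} (swap x y p) j rewrite ↭-length p = begin
    step x (suc (length ys)) (step y (length ys) (rookℤ xs)) j
      ≡⟨ step-cong x _ (step-cong y _ (rookℤ-↭ p)) j ⟩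
    step x (suc (length ys)) (step y (length ys) (rookℤ ys)) j
      ≡⟨ step-comm x y (length ys) (rookℤ ys) j ⟩
    step y (suc (length ys)) (step x (length ys) (rookℤ ys)) j ∎
  rookℤ-↭ (trans p q) j = ≡.trans (rookℤ-↭ p j) (rookℤ-↭ q j)

  excesses : Word → List ℤ
  excesses []      = []
  excesses (U ∷ w) = excesses w
  excesses (D ∷ w) = (+ #U w - + #D w) ∷ excesses w

  length-excesses : ∀ w → length (excesses w) ≡ #D w
  length-excesses []      = ≡.refl
  length-excesses (U ∷ w) = length-excesses w
  length-excesses (D ∷ w) = cong suc (length-excesses w)

  rook≡rookℤ : ∀ w j → + rook w j ≡ rookℤ (excesses w) j
  rook≡rookℤ []      zero    = ≡.refl
  rook≡rookℤ []      (suc j) = ≡.refl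
  rook≡rookℤ (U ∷ w) j       = rook≡rookℤ w j
  rook≡rookℤ (D ∷ w) zero    = rook≡rookℤ w zero
  rook≡rookℤ (D ∷ w) (suc j) = begin
    + (rook w (suc j) ℕ.+ (#U w ∸ j) ℕ.* rook w j)   ≡⟨ cong (λ x → + rook w (suc j) + x) (pos-* (#U w ∸ j) (rook w j)) ⟩
    + rook w (suc j) + + (#U w ∸ j) * + rook w j     ≡⟨ cong₂ _+_ (rook≡rookℤ w (suc j)) sees ⟩
    rookℤ (excesses w) (suc j) + (s + + #D w - + j) * + rook w j
      ≡⟨ cong₂ (λ d r → rookℤ (excesses w) (suc j) + (s + + d - + j) * r) (sym (length-excesses w)) (rook≡rookℤ w j) ⟩
    rookℤ (excesses w) (suc j) + (s + + length (excesses w) - + j) * rookℤ (excesses w) j ∎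
    where
    s = + #U w - + #D w
    sees : + (#U w ∸ j) * + rook w j ≡ (s + + #D w - + j) * + rook w j
    sees with j ≤? #U w
    ... | yes j≤u = cong (_* + rook w j)
        (≡.trans (sym (⊖-≥ j≤u)) (≡.trans (sym (m-n≡m⊖n (#U w) j)) (sym (cancel (+ #U w) (+ #D w) (+ j)))))
      where
      cancel : ∀ u d j → (u - d) + d - j ≡ u - j
      cancel = solve-∀
    ... | no  j≰u rewrite rook-beyond-#U w j (≰⇒> j≰u) = ≡.trans (*-zeroʳ (+ (#U w ∸ j))) (sym (*-zeroʳ (s + + #D w - + j)))

  excesses≡levels : ∀ w → excesses w ≡ map (λ g → + #U w - + g) (levels w)
  excesses≡levels []      = ≡.refl
  excesses≡levels (U ∷ w) = ≡.trans (excesses≡levels w) (≡.trans (map-cong shift (levels w)) (map-∘ (levels w)))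
    where
    shift : ∀ g → + #U w - + g ≡ + suc (#U w) - + suc g
    shift g = ≡.trans (m-n≡m⊖n (#U w) g) (≡.trans (sym ([1+m]⊖[1+n]≡m⊖n (#U w) g)) (sym (m-n≡m⊖n (suc (#U w)) (suc g))))
  excesses≡levels (D ∷ w) = cong ((+ #U w - + #D w) ∷_) (excesses≡levels w)

  rook-↭ : ∀ u v → #U u ≡ #U v → levels u ↭ levels v → ∀ j → rook u j ≡ rook v j
  rook-↭ u v #Uu≡#Uv lu↭lv j = +-injective (begin
    + rook u j               ≡⟨ rook≡rookℤ u j ⟩
    rookℤ (excesses u) j     ≡⟨ rookℤ-↭ excesses-↭ j ⟩
    rookℤ (excesses v) j     ≡⟨ rook≡rookℤ v j ⟨
    + rook v j               ∎)
    where
    excesses-↭ : excesses u ↭ excesses v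
    excesses-↭ rewrite excesses≡levels u | excesses≡levels v | #Uu≡#Uv = map⁺ _ lu↭lv

module Separation {a ℓ} (F : Field a ℓ) (char0 : CharZero F) where

  open Field F hiding (zero)
  open Words
  open Congruence F
  open import Data.Nat as ℕ using (ℕ; zero; suc; _<_; s≤s; _≟_)
  import Data.Nat.Properties as ℕₚ
  open ℕₚ using (n<1+n; <-trans; ≤-antisym; ≮⇒≥)
  open import Data.Nat.Tactic.RingSolver using (solve-∀)
  open import Data.List using (List; []; _∷_; _++_; map; length; deduplicate)
  open import Data.List.Properties using (map-∘; map-cong; map-id; filter-accept; filter-reject)
  open import Data.List.Membership.Propositional using (_∈_)
  open import Data.List.Membership.Propositional.Properties using (∈-deduplicate⁺; ∈-++⁺ˡ; ∈-++⁺ʳ; ∈-map⁺)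
  open import Data.List.Relation.Unary.All as All using (All; []; _∷_)
  open import Data.List.Relation.Unary.Any using (here; there)
  open import Data.List.Relation.Unary.Unique.Propositional using (Unique; []; _∷_)
  open import Data.List.Relation.Unary.Unique.DecPropositional.Properties _≟W_ using (deduplicate-!)
  open import Data.Product using (_×_; _,_; proj₂)
  open import Relation.Nullary using (yes; no; ¬_)
  open import Relation.Binary.PropositionalEquality as ≡ using (_≡_; _≢_)
  open import Function using (_∘_)
  open import Algebra.Properties.Ring ring using (-1*x≈-x; -‿distribˡ-*; +-cancelˡ)
  open import Algebra.Properties.AbelianGroup +-abelianGroup using (⁻¹-∙-comm)
  open import Algebra.Properties.CommutativeSemigroup +-commutativeSemigroup using (interchange)
  open import Algebra.Properties.Group +-group using (x∙y⁻¹≈ε⇒x≈y)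
  open import Relation.Binary.Reasoning.Setoid setoid

  extend : (Word → Carrier) → Combination → Carrier
  extend h []            = 0#
  extend h ((c , x) ∷ A) = c * h x + extend h A

  RespectsWeyl : (Word → Carrier) → Set ℓ
  RespectsWeyl h = ∀ x y → h (x ++ D ∷ U ∷ y) ≈ h (x ++ U ∷ D ∷ y) + h (x ++ y)

  extend-relator : ∀ {h} → RespectsWeyl h → ∀ L → extend h (relator L) ≈ 0#
  extend-relator resp []                        = refl
  extend-relator {h} resp ((c , x , y) ∷ L) = begin
    c * h₁ + (- c * h₂ + (- c * h₃ + extend h (relator L)))
      ≈⟨ +-congˡ (+-congˡ (+-congˡ (extend-relator resp L))) ⟩
    c * h₁ + (- c * h₂ + (- c * h₃ + 0#))
      ≈⟨ +-cong (*-congˡ (resp x y)) (+-cong (sym (-‿distribˡ-* c h₂)) (trans (+-identityʳ _) (sym (-‿distribˡ-* c h₃)))) ⟩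
    c * (h₂ + h₃) + (- (c * h₂) + - (c * h₃)) ≈⟨ +-cong (distribˡ c h₂ h₃) (⁻¹-∙-comm _ _) ⟩
    (c * h₂ + c * h₃) + - (c * h₂ + c * h₃)   ≈⟨ -‿inverseʳ _ ⟩
    0#                                        ∎
    where
    h₁ = h (x ++ D ∷ U ∷ y)
    h₂ = h (x ++ U ∷ D ∷ y)
    h₃ = h (x ++ y)

  sumOver : List Word → (Word → Carrier) → Carrier
  sumOver []      f = 0#
  sumOver (w ∷ S) f = f w + sumOver S f

  sumOver-cong : ∀ S {f g} → (∀ w → f w ≈ g w) → sumOver S f ≈ sumOver S g
  sumOver-cong []      f≈g = refl
  sumOver-cong (w ∷ S) f≈g = +-cong (f≈g w) (sumOver-cong S f≈g)

  sumOver-+ : ∀ S f g → sumOver S (λ w → f w + g w) ≈ sumOver S f + sumOver S g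
  sumOver-+ []      f g = sym (+-identityʳ _)
  sumOver-+ (w ∷ S) f g = trans (+-congˡ (sumOver-+ S f g)) (interchange _ _ _ _)

  sumOver-zero : ∀ S f → (∀ w → w ∈ S → f w ≈ 0#) → sumOver S f ≈ 0#
  sumOver-zero []      f f≈0 = refl
  sumOver-zero (w ∷ S) f f≈0 = trans (+-cong (f≈0 w (here ≡.refl)) (sumOver-zero S f (λ w′ → f≈0 w′ ∘ there))) (+-identityʳ _)

  term-vanishes : ∀ (h : Word → Carrier) c {x w} → x ≢ w → c * indicator x w * h w ≈ 0#
  term-vanishes h c x≢w = trans (*-congʳ (trans (*-congˡ (indicator-≢ x≢w)) (zeroʳ c))) (zeroˡ _)

  sumOver-indicator : ∀ (h : Word → Carrier) c x S → x ∈ S → Unique S → sumOver S (λ w → c * indicator x w * h w) ≈ c * h x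
  sumOver-indicator h c x (x ∷ S) (here ≡.refl) (x∉S ∷ _) = begin
    c * indicator x x * h x + sumOver S (λ w → c * indicator x w * h w)
      ≈⟨ +-cong (*-congʳ (trans (*-congˡ (indicator-≡ {x} ≡.refl)) (*-identityʳ c)))
                (sumOver-zero S _ (λ w w∈S → term-vanishes h c (All.lookup x∉S w∈S))) ⟩
    c * h x + 0#  ≈⟨ +-identityʳ _ ⟩
    c * h x       ∎
  sumOver-indicator h c x (y ∷ S) (there x∈S) (y∉S ∷ uS) = begin
    c * indicator x y * h y + sumOver S (λ w → c * indicator x w * h w)
      ≈⟨ +-cong (term-vanishes h c (λ x≡y → All.lookup y∉S x∈S (≡.sym x≡y))) (sumOver-indicator h c x S x∈S uS) ⟩
    0# + c * h x  ≈⟨ +-identityˡ _ ⟩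
    c * h x       ∎

  extend≈sumOver : ∀ (h : Word → Carrier) A S → Unique S → All (λ e → proj₂ e ∈ S) A →
      extend h A ≈ sumOver S (λ w → cf A w * h w)
  extend≈sumOver h []            S uS []          = sym (sumOver-zero S (λ w → 0# * h w) (λ w _ → zeroˡ _))
  extend≈sumOver h ((c , x) ∷ A) S uS (x∈S ∷ A⊆S) = begin
    c * h x + extend h A  ≈⟨ +-cong (sumOver-indicator h c x S x∈S uS) (sym (extend≈sumOver h A S uS A⊆S)) ⟨
    sumOver S (λ w → c * indicator x w * h w) + sumOver S (λ w → cf A w * h w) ≈⟨ sumOver-+ S _ _ ⟨
    sumOver S (λ w → c * indicator x w * h w + cf A w * h w)
      ≈⟨ sumOver-cong S (λ w → trans (*-congʳ (cf-∷ c x A w)) (distribʳ (h w) _ _)) ⟨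
    sumOver S (λ w → cf ((c , x) ∷ A) w * h w) ∎

  extend-cong : ∀ (h : Word → Carrier) A B → (∀ w → cf A w ≈ cf B w) → extend h A ≈ extend h B
  extend-cong h A B A≈B = begin
    extend h A                      ≈⟨ extend≈sumOver h A S uS (All.tabulate (support ∘ ∈-++⁺ˡ)) ⟩
    sumOver S (λ w → cf A w * h w)  ≈⟨ sumOver-cong S (λ w → *-congʳ (A≈B w)) ⟩
    sumOver S (λ w → cf B w * h w)  ≈⟨ extend≈sumOver h B S uS (All.tabulate (support ∘ ∈-++⁺ʳ A)) ⟨
    extend h B                      ∎
    where
    S = deduplicate _≟W_ (map proj₂ (A ++ B))
    uS : Unique S
    uS = deduplicate-! (map proj₂ (A ++ B))
    support : ∀ {e} → e ∈ A ++ B → proj₂ e ∈ S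
    support = ∈-deduplicate⁺ _≟W_ ∘ ∈-map⁺ proj₂

  respectsWeyl⇒≈ : ∀ {h} → RespectsWeyl h → ∀ {u v} → WeylEquiv F u v → h u ≈ h v
  respectsWeyl⇒≈ {h} resp {u} {v} (L , u-v≈relator) = x∙y⁻¹≈ε⇒x≈y (h u) (h v) (begin
    h u + - h v                                 ≈⟨ +-cong (*-identityˡ (h u)) (trans (+-identityʳ _) (-1*x≈-x (h v))) ⟨
    1# * h u + (- 1# * h v + 0#)                ≈⟨ extend-cong h ((1# , u) ∷ (- 1# , v) ∷ []) (relator L) u-v≈relator ⟩
    extend h (relator L)                        ≈⟨ extend-relator resp L ⟩
    0#                                          ∎)

  ι-injective : ∀ m n → ι m ≈ ι n → m ≡ n
  ι-injective zero    zero    _   = ≡.refl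
  ι-injective zero    (suc n) 0≈n with () ← char0 (suc n) (sym 0≈n)
  ι-injective (suc m) zero    m≈0 with () ← char0 (suc m) m≈0
  ι-injective (suc m) (suc n) m≈n = ≡.cong suc (ι-injective m n (+-cancelˡ 1# _ _ m≈n))

  *-nonzero : ∀ {b f} → ¬ b ≈ 0# → ¬ f ≈ 0# → ¬ b * f ≈ 0#
  *-nonzero {b} {f} b≉0 f≉0 bf≈0 with inverse b b≉0
  ... | b⁻¹ , bb⁻¹≈1 = f≉0 (begin
    f              ≈⟨ *-identityˡ f ⟨
    1# * f         ≈⟨ *-congʳ (trans (sym bb⁻¹≈1) (*-comm b b⁻¹)) ⟩
    b⁻¹ * b * f    ≈⟨ *-assoc _ _ _ ⟩
    b⁻¹ * (b * f)  ≈⟨ *-congˡ bf≈0 ⟩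
    b⁻¹ * 0#       ≈⟨ zeroʳ _ ⟩
    0#             ∎)

  Poly : Set a
  Poly = ℕ → Carrier

  _≐_ : Poly → Poly → Set ℓ
  f ≐ g = ∀ j → f j ≈ g j

  _⊕_ : Poly → Poly → Poly
  (f ⊕ g) j = f j + g j

  one : Poly
  one zero    = 1#
  one (suc j) = 0#

  X+_·_ : Carrier → Poly → Poly
  (X+ b · f) zero    = b * f zero
  (X+ b · f) (suc j) = b * f (suc j) + f j

  ·-cong : ∀ {b b′ f g} → b ≈ b′ → f ≐ g → (X+ b · f) ≐ (X+ b′ · g)
  ·-cong b≈b′ f≐g zero    = *-cong b≈b′ (f≐g zero)
  ·-cong b≈b′ f≐g (suc j) = +-cong (*-cong b≈b′ (f≐g (suc j))) (f≐g j)

  ·-distrib-⊕ : ∀ b f g → (X+ b · (f ⊕ g)) ≐ ((X+ b · f) ⊕ (X+ b · g))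
  ·-distrib-⊕ b f g zero    = distribˡ b _ _
  ·-distrib-⊕ b f g (suc j) = trans (+-congʳ (distribˡ b _ _)) (interchange _ _ _ _)

  X+[b+1]· : ∀ b f → (X+ (b + 1#) · f) ≐ ((X+ b · f) ⊕ f)
  X+[b+1]· b f zero    = trans (distribʳ _ _ _) (+-congˡ (*-identityˡ _))
  X+[b+1]· b f (suc j) = begin
    (b + 1#) * f (suc j) + f j          ≈⟨ +-congʳ (trans (distribʳ _ _ _) (+-congˡ (*-identityˡ _))) ⟩
    (b * f (suc j) + f (suc j)) + f j   ≈⟨ +-assoc _ _ _ ⟩
    b * f (suc j) + (f (suc j) + f j)   ≈⟨ +-congˡ (+-comm _ _) ⟩
    b * f (suc j) + (f j + f (suc j))   ≈⟨ +-assoc _ _ _ ⟨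
    (b * f (suc j) + f j) + f (suc j)   ∎

  Order : Poly → ℕ → Set ℓ
  Order f v = (∀ j → j < v → f j ≈ 0#) × ¬ f v ≈ 0#

  Order-X· : ∀ {b f v} → b ≈ 0# → Order f v → Order (X+ b · f) (suc v)
  Order-X· {b} {f} {v} b≈0 (below , at) = below′ , λ e → at (trans (sym (trans (+-congʳ b·≈0) (+-identityˡ _))) e)
    where
    b·≈0 : ∀ {x} → b * x ≈ 0#
    b·≈0 = trans (*-congʳ b≈0) (zeroˡ _)
    below′ : ∀ j → j < suc v → (X+ b · f) j ≈ 0#
    below′ zero    _       = b·≈0
    below′ (suc j) (s≤s j<v) = trans (+-cong b·≈0 (below j j<v)) (+-identityˡ _)

  Order-unit· : ∀ {b f v} → ¬ b ≈ 0# → Order f v → Order (X+ b · f) v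
  Order-unit· {b} {f} {v} b≉0 (below , at) = below′ , at′ v ≡.refl
    where
    below′ : ∀ j → j < v → (X+ b · f) j ≈ 0#
    below′ zero    j<v = trans (*-congˡ (below zero j<v)) (zeroʳ b)
    below′ (suc j) j<v = trans
        (+-cong (trans (*-congˡ (below (suc j) j<v)) (zeroʳ b))
            (below j (<-trans (n<1+n j) j<v))) (+-identityʳ _)
    at′ : ∀ v′ → v′ ≡ v → ¬ (X+ b · f) v′ ≈ 0#
    at′ zero     ≡.refl e = *-nonzero b≉0 at e
    at′ (suc v′) ≡.refl e = *-nonzero b≉0 at (trans (sym (+-identityʳ _)) (trans (+-congˡ (sym (below v′ (n<1+n v′)))) e))

  -- poly w = ∏ over the D's of w of (X + ι (p + t) − ι (q + M)), p and q the
  -- numbers of U's and D's after that D.  It respects DU = UD + 1, and when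
  -- M = #U w its order at 0 is the multiplicity of t among the levels of w.
  module FactorPolynomial (t M : ℕ) where

    root : ℕ → ℕ → Carrier
    root p q = ι (p ℕ.+ t) + - ι (q ℕ.+ M)

    mulFactors : Word → ℕ → ℕ → Poly → Poly
    mulFactors []      p q f = f
    mulFactors (U ∷ x) p q f = mulFactors x p q f
    mulFactors (D ∷ x) p q f = X+ root (#U x ℕ.+ p) (#D x ℕ.+ q) · mulFactors x p q f

    poly : Word → Poly
    poly w = mulFactors w 0 0 one

    root-suc : ∀ p q → root (suc p) (suc q) ≈ root p q
    root-suc p q = begin
      (1# + ι (p ℕ.+ t)) + - (1# + ι (q ℕ.+ M))    ≈⟨ +-congˡ (⁻¹-∙-comm _ _) ⟨
      (1# + ι (p ℕ.+ t)) + (- 1# + - ι (q ℕ.+ M))  ≈⟨ interchange _ _ _ _ ⟩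
      (1# + - 1#) + root p q                       ≈⟨ +-congʳ (-‿inverseʳ 1#) ⟩
      0# + root p q                                ≈⟨ +-identityˡ _ ⟩
      root p q                                     ∎

    mulFactors-cong : ∀ x p q {f g} → f ≐ g → mulFactors x p q f ≐ mulFactors x p q g
    mulFactors-cong []      p q f≐g = f≐g
    mulFactors-cong (U ∷ x) p q f≐g = mulFactors-cong x p q f≐g
    mulFactors-cong (D ∷ x) p q f≐g = ·-cong refl (mulFactors-cong x p q f≐g)

    mulFactors-⊕ : ∀ x p q f g → mulFactors x p q (f ⊕ g) ≐ (mulFactors x p q f ⊕ mulFactors x p q g)
    mulFactors-⊕ []      p q f g j = refl
    mulFactors-⊕ (U ∷ x) p q f g   = mulFactors-⊕ x p q f g
    mulFactors-⊕ (D ∷ x) p q f g j = trans (·-cong refl (mulFactors-⊕ x p q f g) j) (·-distrib-⊕ _ _ _ j)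

    mulFactors-suc : ∀ x p q f → mulFactors x (suc p) (suc q) f ≐ mulFactors x p q f
    mulFactors-suc []      p q f j = refl
    mulFactors-suc (U ∷ x) p q f   = mulFactors-suc x p q f
    mulFactors-suc (D ∷ x) p q f   = ·-cong root≈ (mulFactors-suc x p q f)
      where
      root≈ : root (#U x ℕ.+ suc p) (#D x ℕ.+ suc q) ≈ root (#U x ℕ.+ p) (#D x ℕ.+ q)
      root≈ rewrite ℕₚ.+-suc (#U x) p | ℕₚ.+-suc (#D x) q = root-suc (#U x ℕ.+ p) (#D x ℕ.+ q)

    mulFactors-++ : ∀ x z p q f → mulFactors (x ++ z) p q f ≐ mulFactors x (#U z ℕ.+ p) (#D z ℕ.+ q) (mulFactors z p q f)
    mulFactors-++ []      z p q f j = refl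
    mulFactors-++ (U ∷ x) z p q f   = mulFactors-++ x z p q f
    mulFactors-++ (D ∷ x) z p q f   = ·-cong (reflexive root≡) (mulFactors-++ x z p q f)
      where
      root≡ : root (#U (x ++ z) ℕ.+ p) (#D (x ++ z) ℕ.+ q) ≡ root (#U x ℕ.+ (#U z ℕ.+ p)) (#D x ℕ.+ (#D z ℕ.+ q))
      root≡ rewrite #U-++ x z | #D-++ x z | ℕₚ.+-assoc (#U x) (#U z) p | ℕₚ.+-assoc (#D x) (#D z) q = ≡.refl

    poly-respectsWeyl : ∀ j → RespectsWeyl (λ w → poly w j)
    poly-respectsWeyl j x y = begin
      poly (x ++ D ∷ U ∷ y) j                            ≈⟨ mulFactors-++ x (D ∷ U ∷ y) 0 0 one j ⟩
      mulFactors x p q (X+ root (suc u) d · poly y) j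
        ≈⟨ mulFactors-cong x p q (·-cong (trans (+-assoc _ _ _) (+-comm _ _)) (λ _ → refl)) j ⟩
      mulFactors x p q (X+ (r + 1#) · poly y) j           ≈⟨ mulFactors-cong x p q (X+[b+1]· r (poly y)) j ⟩
      mulFactors x p q ((X+ r · poly y) ⊕ poly y) j       ≈⟨ mulFactors-⊕ x p q _ _ j ⟩
      mulFactors x p q (X+ r · poly y) j + mulFactors x p q (poly y) j
        ≈⟨ +-cong (mulFactors-++ x (U ∷ D ∷ y) 0 0 one j)
          (trans (mulFactors-++ x y 0 0 one j) (sym (mulFactors-suc x u d (poly y) j))) ⟨
      poly (x ++ U ∷ D ∷ y) j + poly (x ++ y) j          ∎
      where
      u = #U y ℕ.+ 0
      d = #D y ℕ.+ 0
      p = suc u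
      q = suc d
      r = root u d

    order-poly : ∀ K w → M ≡ K ℕ.+ #U w → Order (poly w) (multiplicity t (map (K ℕ.+_) (levels w)))
    order-poly K []      _   = (λ j ()) , λ 1≈0 → 0≉1 (sym 1≈0)
    order-poly K (U ∷ w) M≡K+u = ≡.subst (Order (poly w)) (≡.cong (multiplicity t) shift)
                                          (order-poly (suc K) w (≡.trans M≡K+u (ℕₚ.+-suc K (#U w))))
      where
      shift : map (suc K ℕ.+_) (levels w) ≡ map (K ℕ.+_) (map suc (levels w))
      shift = ≡.trans (map-cong (λ g → ≡.sym (ℕₚ.+-suc K g)) (levels w)) (map-∘ (levels w))
    order-poly K (D ∷ w) M≡K+u with K ℕ.+ #D w ≟ t
    ... | yes K+d≡t = ≡.subst (Order (poly (D ∷ w))) (≡.sym (≡.cong length (filter-accept (_≟ t) K+d≡t)))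
                             (Order-X· (trans (+-congʳ (reflexive (≡.cong ι (balanced K+d≡t)))) (-‿inverseʳ _))
                                 (order-poly K w M≡K+u))
      where
      balanced : K ℕ.+ #D w ≡ t → #U w ℕ.+ 0 ℕ.+ t ≡ #D w ℕ.+ 0 ℕ.+ M
      balanced ≡.refl rewrite M≡K+u = swap (#U w) (#D w) K
        where
        swap : ∀ u d K → u ℕ.+ 0 ℕ.+ (K ℕ.+ d) ≡ d ℕ.+ 0 ℕ.+ (K ℕ.+ u)
        swap = solve-∀
    ... | no  K+d≢t = ≡.subst (Order (poly (D ∷ w))) (≡.sym (≡.cong length (filter-reject (_≟ t) K+d≢t)))
                             (Order-unit· (λ r≈0 → K+d≢t (unbalanced (ι-injective _ _ (x∙y⁻¹≈ε⇒x≈y _ _ r≈0))))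
                                 (order-poly K w M≡K+u))
      where
      unbalanced : #U w ℕ.+ 0 ℕ.+ t ≡ #D w ℕ.+ 0 ℕ.+ M → K ℕ.+ #D w ≡ t
      unbalanced e rewrite M≡K+u =
        ≡.sym (ℕₚ.+-cancelˡ-≡ (#U w) t (K ℕ.+ #D w) (≡.trans (dropˡ (#U w) t) (≡.trans e (dropʳ (#U w) (#D w) K))))
        where
        dropˡ : ∀ u t → u ℕ.+ t ≡ u ℕ.+ 0 ℕ.+ t
        dropˡ = solve-∀
        dropʳ : ∀ u d K → d ℕ.+ 0 ℕ.+ (K ℕ.+ u) ≡ u ℕ.+ (K ℕ.+ d)
        dropʳ = solve-∀

  lower-order-impossible : ∀ {f g m n} → f ≐ g → Order f m → Order g n → ¬ m < n
  lower-order-impossible f≐g (_ , fm≉0) (g-below , _) m<n = fm≉0 (trans (f≐g _) (g-below _ m<n))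

  weylEquiv⇒multiplicity≡ : ∀ {u v} → #U u ≡ #U v → WeylEquiv F u v → ∀ t →
      multiplicity t (levels u) ≡ multiplicity t (levels v)
  weylEquiv⇒multiplicity≡ {u} {v} #Uu≡#Uv u≈v t =
    ≤-antisym (≮⇒≥ (lower-order-impossible (λ j → sym (same j)) order-v order-u))
              (≮⇒≥ (lower-order-impossible same order-u order-v))
    where
    open FactorPolynomial t (#U u)
    order-u : Order (poly u) (multiplicity t (levels u))
    order-u = ≡.subst (Order (poly u)) (≡.cong (multiplicity t) (map-id (levels u))) (order-poly 0 u ≡.refl)
    order-v : Order (poly v) (multiplicity t (levels v))
    order-v = ≡.subst (Order (poly v)) (≡.cong (multiplicity t) (map-id (levels v))) (order-poly 0 v #Uu≡#Uv)
    same : poly u ≐ poly v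
    same j = respectsWeyl⇒≈ {λ w → poly w j} (poly-respectsWeyl j) {u} {v} u≈v

module LevelSequences where

  open Words
  open import Data.Nat using (ℕ; zero; suc; _+_; _∸_; _≤_; _≟_; s≤s; z≤n)
  open import Data.Nat.Properties
  open import Data.List using (List; []; _∷_; _++_; map; replicate; length)
  open import Data.List.Properties using (map-∘; map-cong; map-id; length-map; map-injective)
  open import Data.List.Membership.Propositional using (_∈_)
  open import Data.List.Relation.Unary.Any using (here; there)
  open import Data.Product using (_×_; _,_)
  open import Relation.Nullary using (yes; no; contradiction)
  open import Relation.Binary.PropositionalEquality as ≡ using (_≡_; cong)
  open ≡.≡-Reasoning

  -- The level sequences of words are exactly the chains: each entry is at
  -- most one more than the next one.
  Chain : ℕ → ℕ → List ℕ → Set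
  Chain M p []       = p ≤ M
  Chain M p (z ∷ zs) = p ≤ suc z × Chain M z zs

  Chain-weaken : ∀ {M p p′} zs → p′ ≤ p → Chain M p zs → Chain M p′ zs
  Chain-weaken []       p′≤p p≤M       = ≤-trans p′≤p p≤M
  Chain-weaken (z ∷ zs) p′≤p (p≤z , c) = ≤-trans p′≤p p≤z , c

  Chain-suc : ∀ {M p} zs → Chain M p zs → Chain (suc M) (suc p) (map suc zs)
  Chain-suc []       p≤M       = s≤s p≤M
  Chain-suc (z ∷ zs) (p≤z , c) = s≤s p≤z , Chain-suc zs c

  Chain-++ : ∀ {M p} xs y ys → Chain (suc y) p xs → Chain M y ys → Chain M p (xs ++ y ∷ ys)
  Chain-++ []       y ys p≤y       c′ = p≤y , c′
  Chain-++ (x ∷ xs) y ys (p≤x , c) c′ = p≤x , Chain-++ xs y ys c c′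

  Chain-levels : ∀ w → Chain (#U w) (#D w) (levels w)
  Chain-levels []      = z≤n
  Chain-levels (U ∷ w) = Chain-weaken (map suc (levels w)) (n≤1+n _) (Chain-suc (levels w) (Chain-levels w))
  Chain-levels (D ∷ w) = ≤-refl , Chain-levels w

  Chain-between : ∀ {M p} zs → Chain M p zs → ∀ {x z} → x ∈ zs → M ≤ z → z ≤ x → z ∈ zs
  Chain-between (y ∷ zs) (_ , c) (there x∈zs) M≤z z≤x = there (Chain-between zs c x∈zs M≤z z≤x)
  Chain-between {M} (y ∷ zs) (_ , c) {z = z} (here ≡.refl) M≤z z≤y with z ≟ y
  ... | yes ≡.refl = here ≡.refl
  ... | no  z≢y    = there (below zs c)
    where
    below : ∀ zs → Chain M y zs → z ∈ zs
    below []        y≤M         = contradiction (≤-trans y≤M M≤z) (<⇒≱ (≤∧≢⇒< z≤y z≢y))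
    below (y′ ∷ zs) (y≤y′ , c′) = Chain-between (y′ ∷ zs) (y≤y′ , c′) (here ≡.refl) M≤z
                                                (≤-pred (≤-trans (≤∧≢⇒< z≤y z≢y) y≤y′))

  length-levels : ∀ w → length (levels w) ≡ #D w
  length-levels []      = ≡.refl
  length-levels (U ∷ w) = ≡.trans (length-map suc (levels w)) (length-levels w)
  length-levels (D ∷ w) = cong suc (length-levels w)

  Us : ℕ → Word → Word
  Us e w = replicate e U ++ w

  #D-Us : ∀ e w → #D (Us e w) ≡ #D w
  #D-Us zero    w = ≡.refl
  #D-Us (suc e) w = #D-Us e w

  #U-Us : ∀ e w → #U (Us e w) ≡ e + #U w
  #U-Us zero    w = ≡.refl
  #U-Us (suc e) w = cong suc (#U-Us e w)

  levels-Us : ∀ e w → levels (Us e w) ≡ map (e +_) (levels w)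
  levels-Us zero    w = ≡.sym (map-id (levels w))
  levels-Us (suc e) w = ≡.trans (cong (map suc) (levels-Us e w)) (≡.sym (map-∘ (levels w)))

  wordOf : ℕ → ℕ → List ℕ → Word
  wordOf m p []       = Us (m ∸ p) []
  wordOf m p (z ∷ zs) = Us (suc z ∸ p) (D ∷ wordOf m z zs)

  #D-wordOf : ∀ m p zs → #D (wordOf m p zs) ≡ length zs
  #D-wordOf m p []       = #D-Us (m ∸ p) []
  #D-wordOf m p (z ∷ zs) = ≡.trans (#D-Us (suc z ∸ p) _) (cong suc (#D-wordOf m z zs))

  #U-wordOf : ∀ m p zs → Chain m p zs → #U (wordOf m p zs) + p ≡ m + length zs
  #U-wordOf m p []       p≤m = begin
    #U (Us (m ∸ p) []) + p   ≡⟨ cong (_+ p) (≡.trans (#U-Us (m ∸ p) []) (+-identityʳ _)) ⟩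
    m ∸ p + p                ≡⟨ m∸n+n≡m p≤m ⟩
    m                        ≡⟨ +-identityʳ m ⟨
    m + 0                    ∎
  #U-wordOf m p (z ∷ zs) (p≤z , c) = begin
    #U (Us (suc z ∸ p) (D ∷ wordOf m z zs)) + p ≡⟨ cong (_+ p) (#U-Us (suc z ∸ p) _) ⟩
    (suc z ∸ p) + u + p                         ≡⟨ cong (_+ p) (+-comm (suc z ∸ p) u) ⟩
    u + (suc z ∸ p) + p                         ≡⟨ +-assoc u _ p ⟩
    u + ((suc z ∸ p) + p)                       ≡⟨ cong (u +_) (m∸n+n≡m p≤z) ⟩
    u + suc z                                   ≡⟨ +-suc u z ⟩
    suc (u + z)                                 ≡⟨ cong suc (#U-wordOf m z zs c) ⟩
    suc (m + length zs)                         ≡⟨ +-suc m _ ⟨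
    m + length (z ∷ zs)                         ∎
    where u = #U (wordOf m z zs)

  levels-wordOf : ∀ m p zs → Chain m p zs → map (p +_) (levels (wordOf m p zs)) ≡ map (length zs +_) zs
  levels-wordOf m p []       _ = cong (map (p +_)) (levels-Us (m ∸ p) [])
  levels-wordOf m p (z ∷ zs) (p≤z , c) = begin
    map (p +_) (levels (Us e (D ∷ w)))           ≡⟨ cong (map (p +_)) (levels-Us e (D ∷ w)) ⟩
    map (p +_) (map (e +_) (#D w ∷ levels w))    ≡⟨ map-∘ (#D w ∷ levels w) ⟨
    map (λ g → p + (e + g)) (#D w ∷ levels w)
      ≡⟨ map-cong (λ g → ≡.trans (≡.sym (+-assoc p e g)) (cong (_+ g) p+e≡1+z)) (#D w ∷ levels w) ⟩
    map (suc z +_) (#D w ∷ levels w)             ≡⟨ ≡.cong₂ _∷_ head tail ⟩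
    map (suc (length zs) +_) (z ∷ zs)            ∎
    where
    e = suc z ∸ p
    w = wordOf m z zs
    p+e≡1+z : p + e ≡ suc z
    p+e≡1+z = m+[n∸m]≡n p≤z
    head : suc z + #D w ≡ suc (length zs) + z
    head = ≡.trans (cong (suc z +_) (#D-wordOf m z zs)) (cong suc (+-comm z (length zs)))
    tail : map (suc z +_) (levels w) ≡ map (suc (length zs) +_) zs
    tail = ≡.trans (map-∘ (levels w)) (≡.trans (cong (map suc) (levels-wordOf m z zs c)) (≡.sym (map-∘ zs)))

  levels-wordOf-full : ∀ m k zs → length zs ≡ k → Chain m k zs → levels (wordOf m k zs) ≡ zs
  levels-wordOf-full m k zs ∣zs∣≡k c =
    map-injective (λ {x} {y} → +-cancelˡ-≡ k x y) (≡.trans (levels-wordOf m k zs c) (cong (λ n → map (n +_) zs) ∣zs∣≡k))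

  #U-wordOf-full : ∀ m k zs → length zs ≡ k → Chain m k zs → #U (wordOf m k zs) ≡ m
  #U-wordOf-full m k zs ∣zs∣≡k c = +-cancelʳ-≡ k _ _ (≡.trans (#U-wordOf m k zs c) (cong (m +_) ∣zs∣≡k))

module Admissibility (c k : ℕ) where

  open Words
  open LevelSequences using (length-levels)
  open import Data.Nat using (ℕ; suc; _+_; _*_; _∸_; _≤_)
  open import Data.Nat.Properties
  open import Data.List using (List; []; _∷_; _++_; map; length)
  open import Data.List.Properties using (length-map; ∷-injectiveʳ)
  open import Data.Product using (_×_; _,_)
  open import Data.Unit using (⊤; tt)
  open import Relation.Binary.PropositionalEquality as ≡ using (_≡_; cong; subst; subst₂)

  -- InM c with d letters D and u letters U already read; InM c is InMFrom 0 0.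
  InMFrom : ℕ → ℕ → Word → Set
  InMFrom d u w = ∀ p s → p ++ s ≡ w → c * (d + #D p) ≤ u + #U p

  Admissible : ℕ → ℕ → Word → Set
  Admissible d u []      = c * d ≤ u
  Admissible d u (U ∷ w) = c * d ≤ u × Admissible d (suc u) w
  Admissible d u (D ∷ w) = c * d ≤ u × Admissible (suc d) u w

  Admissible-head : ∀ d u w → Admissible d u w → c * d ≤ u
  Admissible-head d u []      cd≤u       = cd≤u
  Admissible-head d u (U ∷ w) (cd≤u , _) = cd≤u
  Admissible-head d u (D ∷ w) (cd≤u , _) = cd≤u

  empty-prefix : ∀ {d u w} → InMFrom d u w → c * d ≤ u
  empty-prefix {d} {u} {w} h = subst₂ _≤_ (cong (c *_) (+-identityʳ d)) (+-identityʳ u) (h [] w ≡.refl)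

  InMFrom⇒Admissible : ∀ w d u → InMFrom d u w → Admissible d u w
  InMFrom⇒Admissible []      d u h = empty-prefix h
  InMFrom⇒Admissible (U ∷ w) d u h = empty-prefix h ,
    InMFrom⇒Admissible w d (suc u) (λ p s e → subst (c * (d + #D p) ≤_) (+-suc u (#U p)) (h (U ∷ p) s (cong (U ∷_) e)))
  InMFrom⇒Admissible (D ∷ w) d u h = empty-prefix h ,
    InMFrom⇒Admissible w (suc d) u
        (λ p s e → subst (_≤ u + #U p) (cong (c *_) (+-suc d (#D p))) (h (D ∷ p) s (cong (D ∷_) e)))

  Admissible⇒InMFrom : ∀ w d u → Admissible d u w → InMFrom d u w
  Admissible⇒InMFrom w d u a [] s e =
    subst₂ _≤_ (cong (c *_) (≡.sym (+-identityʳ d))) (≡.sym (+-identityʳ u)) (Admissible-head d u w a)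
  Admissible⇒InMFrom (U ∷ w) d u (_ , a) (U ∷ p) s e =
    subst (c * (d + #D p) ≤_) (≡.sym (+-suc u (#U p))) (Admissible⇒InMFrom w d (suc u) a p s (∷-injectiveʳ e))
  Admissible⇒InMFrom (D ∷ w) d u (_ , a) (D ∷ p) s e =
    subst (_≤ u + #U p) (cong (c *_) (≡.sym (+-suc d (#D p)))) (Admissible⇒InMFrom w (suc d) u a p s (∷-injectiveʳ e))
  Admissible⇒InMFrom (U ∷ w) d u _ (D ∷ p) s ()
  Admissible⇒InMFrom (D ∷ w) d u _ (U ∷ p) s ()

  LevelCond : ℕ → ℕ → List ℕ → Set
  LevelCond d u []       = ⊤
  LevelCond d u (g ∷ gs) = c * suc d + length gs ≤ u + g × LevelCond (suc d) u gs

  LevelCond-suc⁺ : ∀ d u xs → LevelCond d (suc u) xs → LevelCond d u (map suc xs)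
  LevelCond-suc⁺ d u []       _       = tt
  LevelCond-suc⁺ d u (x ∷ xs) (h , r) =
    subst₂ _≤_ (cong (c * suc d +_) (≡.sym (length-map suc xs))) (≡.sym (+-suc u x)) h , LevelCond-suc⁺ (suc d) u xs r

  LevelCond-suc⁻ : ∀ d u xs → LevelCond d u (map suc xs) → LevelCond d (suc u) xs
  LevelCond-suc⁻ d u []       _       = tt
  LevelCond-suc⁻ d u (x ∷ xs) (h , r) =
    subst₂ _≤_ (cong (c * suc d +_) (length-map suc xs)) (+-suc u x) h , LevelCond-suc⁻ (suc d) u xs r

  Admissible⇒LevelCond : ∀ w d u → Admissible d u w → LevelCond d u (levels w)
  Admissible⇒LevelCond []      d u _       = tt
  Admissible⇒LevelCond (U ∷ w) d u (_ , a) = LevelCond-suc⁺ d u (levels w) (Admissible⇒LevelCond w d (suc u) a)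
  Admissible⇒LevelCond (D ∷ w) d u (_ , a) =
    subst (λ n → c * suc d + n ≤ u + #D w) (≡.sym (length-levels w)) (+-monoˡ-≤ (#D w) (Admissible-head (suc d) u w a)) ,
    Admissible⇒LevelCond w (suc d) u a

  LevelCond⇒Admissible : ∀ w d u → c * d ≤ u → LevelCond d u (levels w) → Admissible d u w
  LevelCond⇒Admissible []      d u cd≤u _       = cd≤u
  LevelCond⇒Admissible (U ∷ w) d u cd≤u l       = cd≤u , LevelCond⇒Admissible w d (suc u) (m≤n⇒m≤1+n cd≤u)
      (LevelCond-suc⁻ d u (levels w) l)
  LevelCond⇒Admissible (D ∷ w) d u cd≤u (h , l) = cd≤u , LevelCond⇒Admissible w (suc d) u c[d+1]≤u l
    where
    c[d+1]≤u : c * suc d ≤ u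
    c[d+1]≤u = +-cancelʳ-≤ (#D w) _ _ (subst (λ n → c * suc d + n ≤ u + #D w) (length-levels w) h)

  -- The i-th D (from 0) of an admissible word with k letters D has level at least minLevel i.
  minLevel : ℕ → ℕ
  minLevel i = c * suc i + (k ∸ suc i)

  AboveMin : ℕ → List ℕ → Set
  AboveMin i []       = ⊤
  AboveMin i (z ∷ zs) = minLevel i ≤ z × AboveMin (suc i) zs

  k∸[1+i]≡length : ∀ i zs → i + length (suc i ∷ zs) ≡ k → k ∸ suc i ≡ length zs
  k∸[1+i]≡length i zs e = ≡.trans (cong (_∸ suc i) (≡.sym e))
      (≡.trans (cong (_∸ suc i) (+-suc i (length zs))) (m+n∸m≡n (suc i) (length zs)))

  AboveMin⇒LevelCond : ∀ i zs → i + length zs ≡ k → AboveMin i zs → LevelCond i 0 zs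
  AboveMin⇒LevelCond i []       _ _       = tt
  AboveMin⇒LevelCond i (z ∷ zs) e (h , r) =
    subst (λ n → c * suc i + n ≤ z) (k∸[1+i]≡length i zs e) h , AboveMin⇒LevelCond (suc i) zs
        (≡.trans (≡.sym (+-suc i _)) e) r

  LevelCond⇒AboveMin : ∀ i zs → i + length zs ≡ k → LevelCond i 0 zs → AboveMin i zs
  LevelCond⇒AboveMin i []       _ _       = tt
  LevelCond⇒AboveMin i (z ∷ zs) e (h , r) =
    subst (λ n → c * suc i + n ≤ z) (≡.sym (k∸[1+i]≡length i zs e)) h , LevelCond⇒AboveMin (suc i) zs
        (≡.trans (≡.sym (+-suc i _)) e) r

  InM⇒AboveMin : ∀ w → #D w ≡ k → InM c w → AboveMin 0 (levels w)
  InM⇒AboveMin w #Dw≡k inM = LevelCond⇒AboveMin 0 (levels w) (≡.trans (length-levels w) #Dw≡k)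
                                (Admissible⇒LevelCond w 0 0 (InMFrom⇒Admissible w 0 0 inM))

  AboveMin⇒InM : ∀ w → #D w ≡ k → AboveMin 0 (levels w) → InM c w
  AboveMin⇒InM w #Dw≡k above = Admissible⇒InMFrom w 0 0 (LevelCond⇒Admissible w 0 0 (≤-reflexive (*-zeroʳ c))
                                 (AboveMin⇒LevelCond 0 (levels w) (≡.trans (length-levels w) #Dw≡k) above))

module Representatives (c m k : ℕ) where

  open Words
  open LevelSequences
  open Admissibility c k using (minLevel; AboveMin; AboveMin⇒InM)
  open import Data.Nat using (ℕ; zero; suc; _+_; _*_; _∸_; _≤_; _<_; _≤?_; s≤s; z≤n; pred; >-nonZero)
  open import Data.Nat.Properties
  open import Data.List using (List; []; _∷_; _++_; map; length; reverse; upTo; concatMap; cartesianProduct)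
  open import Data.List.Properties using (length-++; length-reverse; unfold-reverse; ++-identityʳ)
  open import Data.List.Membership.Propositional using (_∈_; find)
  open import Data.List.Membership.Propositional.Properties
    using (∈-++⁺ˡ; ∈-++⁺ʳ; ∈-++⁻; ∈-map⁺; ∈-map⁻; ∈-concatMap⁺; ∈-concatMap⁻; ∈-cartesianProduct⁺;
        ∈-cartesianProduct⁻; ∈-upTo⁺; ∈-upTo⁻)
  open import Data.List.Relation.Unary.All as All using (All; []; _∷_)
  open import Data.List.Relation.Unary.Any as Any using (here)
  open import Data.Product using (∃; _×_; _,_; proj₁; proj₂)
  open import Data.Sum using (inj₁; inj₂)
  open import Data.Unit using (⊤; tt)
  open import Data.Empty using (⊥)
  open import Relation.Nullary using (yes; no; contradiction)
  open import Relation.Binary.PropositionalEquality as ≡ using (_≡_; cong; subst)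

  -- Levels below m (the low part) are encoded by strictly decreasing ballot
  -- lists, levels from m on (the high part) by a 0/1 list of descents.
  BallotList : ℕ → ℕ → List ℕ → Set
  BallotList N zero    []       = ⊤
  BallotList N zero    (_ ∷ _)  = ⊥
  BallotList N (suc j) []       = ⊥
  BallotList N (suc j) (y ∷ yl) = c * suc j ≤ y × y ≤ N × BallotList (pred y) j yl

  ballotLists : ℕ → ℕ → List (List ℕ)
  ballotLists N       zero    = [] ∷ []
  ballotLists zero    (suc j) = []
  ballotLists (suc N) (suc j) with c * suc j ≤? suc N
  ... | yes _ = ballotLists N (suc j) ++ map (suc N ∷_) (ballotLists N j)
  ... | no  _ = ballotLists N (suc j)

  BallotList-weaken : ∀ {N N′} j yl → N ≤ N′ → BallotList N j yl → BallotList N′ j yl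
  BallotList-weaken zero    []       _    _                 = tt
  BallotList-weaken (suc j) (y ∷ yl) N≤N′ (cj≤y , y≤N , b) = cj≤y , ≤-trans y≤N N≤N′ , b

  ∈ballotLists⇒BallotList : ∀ N j {yl} → yl ∈ ballotLists N j → BallotList N j yl
  ∈ballotLists⇒BallotList N       zero    (here ≡.refl) = tt
  ∈ballotLists⇒BallotList (suc N) (suc j) {yl} yl∈ with c * suc j ≤? suc N
  ... | no  _ = BallotList-weaken (suc j) yl (n≤1+n N) (∈ballotLists⇒BallotList N (suc j) yl∈)
  ... | yes cj≤N+1 with ∈-++⁻ (ballotLists N (suc j)) yl∈
  ...   | inj₁ yl∈′ = BallotList-weaken (suc j) yl (n≤1+n N) (∈ballotLists⇒BallotList N (suc j) yl∈′)
  ...   | inj₂ yl∈′ with ∈-map⁻ (suc N ∷_) yl∈′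
  ...     | yl′ , yl′∈ , ≡.refl = cj≤N+1 , ≤-refl , ∈ballotLists⇒BallotList N j yl′∈

  length-BallotList : ∀ N j yl → BallotList N j yl → length yl ≡ j
  length-BallotList N zero    []       _         = ≡.refl
  length-BallotList N (suc j) (y ∷ yl) (_ , _ , b) = cong suc (length-BallotList (pred y) j yl b)

  toLow : List ℕ → List ℕ
  toLow []       = []
  toLow (y ∷ ys) = y + (k ∸ suc (length ys)) ∷ toLow ys

  length-toLow : ∀ ys → length (toLow ys) ≡ length ys
  length-toLow []       = ≡.refl
  length-toLow (y ∷ ys) = cong suc (length-toLow ys)

  highTop : List ℕ → ℕ
  highTop []       = m
  highTop (b ∷ bs) = b + highTop bs

  toHigh : List ℕ → List ℕ
  toHigh []       = m ∷ []
  toHigh (b ∷ bs) = highTop (b ∷ bs) ∷ toHigh bs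

  bitLists : ℕ → List (List ℕ)
  bitLists zero    = [] ∷ []
  bitLists (suc r) = map (0 ∷_) (bitLists r) ++ map (1 ∷_) (bitLists r)

  highLists : ℕ → List (List ℕ)
  highLists zero    = [] ∷ []
  highLists (suc r) = map toHigh (bitLists r)

  HighList : ℕ → List ℕ → Set
  HighList zero    hs = hs ≡ []
  HighList (suc r) hs = ∃ λ bs → bs ∈ bitLists r × hs ≡ toHigh bs

  ∈highLists⇔HighList : ∀ r {hs} → (hs ∈ highLists r → HighList r hs) × (HighList r hs → hs ∈ highLists r)
  ∈highLists⇔HighList zero    = (λ { (here ≡.refl) → ≡.refl }) , λ { ≡.refl → here ≡.refl }
  ∈highLists⇔HighList (suc r) = (λ hs∈ → let bs , bs∈ , e = ∈-map⁻ toHigh hs∈ in bs , bs∈ , e) ,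
                                 λ { (bs , bs∈ , ≡.refl) → ∈-map⁺ toHigh bs∈ }

  ∈bitLists⇒bits : ∀ r {bs} → bs ∈ bitLists r → All (_≤ 1) bs × length bs ≡ r
  ∈bitLists⇒bits zero    (here ≡.refl) = [] , ≡.refl
  ∈bitLists⇒bits (suc r) bs∈ with ∈-++⁻ (map (0 ∷_) (bitLists r)) bs∈
  ... | inj₁ bs∈₀ with ∈-map⁻ (0 ∷_) bs∈₀
  ...   | bs′ , bs′∈ , ≡.refl = let bits , len = ∈bitLists⇒bits r bs′∈ in z≤n ∷ bits , cong suc len
  ∈bitLists⇒bits (suc r) bs∈ | inj₂ bs∈₁ with ∈-map⁻ (1 ∷_) bs∈₁
  ...   | bs′ , bs′∈ , ≡.refl = let bits , len = ∈bitLists⇒bits r bs′∈ in ≤-refl ∷ bits , cong suc len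

  bit∈bitLists : ∀ r {b bs} → b ≤ 1 → bs ∈ bitLists r → b ∷ bs ∈ bitLists (suc r)
  bit∈bitLists r {zero}        _        bs∈ = ∈-++⁺ˡ (∈-map⁺ (0 ∷_) bs∈)
  bit∈bitLists r {suc zero}    _        bs∈ = ∈-++⁺ʳ (map (0 ∷_) (bitLists r)) (∈-map⁺ (1 ∷_) bs∈)
  bit∈bitLists r {suc (suc _)} (s≤s ()) _

  m≤highTop : ∀ bs → m ≤ highTop bs
  m≤highTop []       = ≤-refl
  m≤highTop (b ∷ bs) = ≤-trans (m≤highTop bs) (m≤n+m _ b)

  toHigh≤highTop : ∀ bs → All (_≤ highTop bs) (toHigh bs)
  toHigh≤highTop []       = ≤-refl ∷ []
  toHigh≤highTop (b ∷ bs) = ≤-refl ∷ All.map (λ h → ≤-trans h (m≤n+m _ b)) (toHigh≤highTop bs)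

  m≤toHigh : ∀ bs → All (m ≤_) (toHigh bs)
  m≤toHigh []       = ≤-refl ∷ []
  m≤toHigh (b ∷ bs) = m≤highTop (b ∷ bs) ∷ m≤toHigh bs

  length-toHigh : ∀ bs → length (toHigh bs) ≡ suc (length bs)
  length-toHigh []       = ≡.refl
  length-toHigh (b ∷ bs) = cong suc (length-toHigh bs)

  length-HighList : ∀ r hs → HighList r hs → length hs ≡ r
  length-HighList zero    .[]           ≡.refl           = ≡.refl
  length-HighList (suc r) .(toHigh bs) (bs , bs∈ , ≡.refl) = ≡.trans (length-toHigh bs)
      (cong suc (proj₂ (∈bitLists⇒bits r bs∈)))

  m≤HighList : ∀ r hs → HighList r hs → All (m ≤_) hs
  m≤HighList zero    .[]           ≡.refl           = []
  m≤HighList (suc r) .(toHigh bs) (bs , _ , ≡.refl) = m≤toHigh bs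

  Chain-toHigh : ∀ bs {p} → All (_≤ 1) bs → p ≤ suc (highTop bs) → Chain m p (toHigh bs)
  Chain-toHigh []       _          p≤ = p≤ , ≤-refl
  Chain-toHigh (b ∷ bs) (b≤1 ∷ bits) p≤ = p≤ , Chain-toHigh bs bits (+-monoˡ-≤ (highTop bs) b≤1)

  AboveMin-++ : ∀ i xs ys → AboveMin i xs → AboveMin (i + length xs) ys → AboveMin i (xs ++ ys)
  AboveMin-++ i []       ys _       a = subst (λ n → AboveMin n ys) (+-identityʳ i) a
  AboveMin-++ i (x ∷ xs) ys (h , a) a′ = h , AboveMin-++ (suc i) xs ys a
      (subst (λ n → AboveMin n ys) (+-suc i (length xs)) a′)

  AboveMin-low : ∀ N j yl → BallotList N j yl → AboveMin 0 (reverse (toLow yl))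
  AboveMin-low N zero    []       _              = tt
  AboveMin-low N (suc j) (y ∷ yl) (cj≤y , _ , b) rewrite unfold-reverse (y + (k ∸ suc (length yl))) (toLow yl) =
    AboveMin-++ 0 (reverse (toLow yl)) _ (AboveMin-low (pred y) j yl b) (θ≤ , tt)
    where
    ∣yl∣≡j : length yl ≡ j
    ∣yl∣≡j = length-BallotList (pred y) j yl b
    θ≤ : minLevel (length (reverse (toLow yl))) ≤ y + (k ∸ suc (length yl))
    θ≤ rewrite length-reverse (toLow yl) | length-toLow yl | ∣yl∣≡j = +-monoˡ-≤ (k ∸ suc j) cj≤y

  module _ (1≤c : 1 ≤ c) where

    1≤ballot : ∀ {j y} → c * suc j ≤ y → 1 ≤ y
    1≤ballot {j} cj≤y = ≤-trans (≤-trans 1≤c (m≤m*n c (suc j))) cj≤y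

    pred-shift : ∀ {j y} → j < k → c * suc j ≤ y → pred y + (k ∸ j) ≡ y + (k ∸ suc j)
    pred-shift {j} {y} j<k cj≤y = begin
      pred y + (k ∸ j)             ≡⟨ cong (pred y +_) (+-∸-assoc 1 j<k) ⟩
      pred y + suc (k ∸ suc j)     ≡⟨ +-suc (pred y) _ ⟩
      suc (pred y) + (k ∸ suc j)   ≡⟨ cong (_+ (k ∸ suc j)) (suc-pred y {{>-nonZero (1≤ballot cj≤y)}}) ⟩
      y + (k ∸ suc j)              ∎
      where open ≡.≡-Reasoning

    toLow-bound : ∀ N j yl → BallotList N j yl → j ≤ k → All (_≤ N + (k ∸ j)) (toLow yl)
    toLow-bound N zero    []       _                  _   = []
    toLow-bound N (suc j) (y ∷ yl) (cj≤y , y≤N , b) j<k rewrite length-BallotList (pred y) j yl b =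
      +-monoˡ-≤ _ y≤N ∷ All.map (λ x≤ → ≤-trans x≤ bound) (toLow-bound (pred y) j yl b (<⇒≤ j<k))
      where
      bound : pred y + (k ∸ j) ≤ N + (k ∸ suc j)
      bound = subst (_≤ N + (k ∸ suc j)) (≡.sym (pred-shift j<k cj≤y)) (+-monoˡ-≤ (k ∸ suc j) y≤N)

    Chain-low : ∀ N j yl → BallotList N j yl → j ≤ k → ∀ B → N + (k ∸ j) ≤ B → Chain B k (reverse (toLow yl))
    Chain-low N zero    []       _                  _   B N+k≤B = ≤-trans (m≤n+m k N) N+k≤B
    Chain-low N (suc j) (y ∷ yl) (cj≤y , y≤N , b) j<k B N+k≤B
      rewrite unfold-reverse (y + (k ∸ suc (length yl))) (toLow yl) | length-BallotList (pred y) j yl b =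
      Chain-++ (reverse (toLow yl)) x []
          (Chain-low (pred y) j yl b (<⇒≤ j<k) (suc x)
              (≤-trans (≤-reflexive (pred-shift j<k cj≤y)) (n≤1+n x))) x≤B
      where
      x = y + (k ∸ suc j)
      x≤B : x ≤ B
      x≤B = ≤-trans (+-monoˡ-≤ _ y≤N) N+k≤B

    BallotList⇒∈ballotLists : ∀ N j yl → BallotList N j yl → yl ∈ ballotLists N j
    BallotList⇒∈ballotLists N       zero    []       _                  = here ≡.refl
    BallotList⇒∈ballotLists zero    (suc j) (y ∷ yl) (cj≤y , y≤0 , _)   = contradiction (≤-trans (1≤ballot cj≤y) y≤0) λ ()
    BallotList⇒∈ballotLists (suc N) (suc j) (y ∷ yl) (cj≤y , y≤N+1 , b) with c * suc j ≤? suc N | m≤n⇒m<n∨m≡n y≤N+1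
    ... | yes _     | inj₁ y≤N  = ∈-++⁺ˡ (BallotList⇒∈ballotLists N (suc j) (y ∷ yl) (cj≤y , ≤-pred y≤N , b))
    ... | no  _     | inj₁ y≤N  = BallotList⇒∈ballotLists N (suc j) (y ∷ yl) (cj≤y , ≤-pred y≤N , b)
    ... | yes _     | inj₂ ≡.refl = ∈-++⁺ʳ (ballotLists N (suc j)) (∈-map⁺ (suc N ∷_) (BallotList⇒∈ballotLists N j yl b))
    ... | no  cj≰N+1 | inj₂ ≡.refl = contradiction cj≤y cj≰N+1

    minLevel≤ck : ∀ i → i < k → minLevel i ≤ c * k
    minLevel≤ck i i<k = begin
      c * suc i + (k ∸ suc i)
        ≤⟨ +-monoʳ-≤ (c * suc i)
          (subst (k ∸ suc i ≤_) (*-comm (k ∸ suc i) c) (m≤m*n (k ∸ suc i) c {{>-nonZero 1≤c}})) ⟩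
      c * suc i + c * (k ∸ suc i)   ≡⟨ *-distribˡ-+ c (suc i) (k ∸ suc i) ⟨
      c * (suc i + (k ∸ suc i))     ≡⟨ cong (c *_) (m+[n∸m]≡n i<k) ⟩
      c * k                         ∎
      where open ≤-Reasoning

    AboveMin-high : c * k ≤ m → ∀ i hs → i + length hs ≤ k → All (m ≤_) hs → AboveMin i hs
    AboveMin-high ck≤m i []       _         _            = tt
    AboveMin-high ck≤m i (h ∷ hs) i+∣hs∣≤k (m≤h ∷ m≤hs) =
      ≤-trans (minLevel≤ck i i<k) (≤-trans ck≤m m≤h) , AboveMin-high ck≤m (suc i) hs
          (subst (_≤ k) (+-suc i (length hs)) i+∣hs∣≤k) m≤hs
      where
      i<k : i < k
      i<k = ≤-trans (subst (_≤ i + length (h ∷ hs)) (+-comm i 1) (+-monoʳ-≤ i (s≤s z≤n))) i+∣hs∣≤k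

  lowBound : ℕ → ℕ
  lowBound j = m ∸ k + j ∸ 1

  Pair : Set
  Pair = List ℕ × List ℕ

  block : ℕ → List Pair
  block j = cartesianProduct (ballotLists (lowBound j) j) (highLists (k ∸ j))

  representatives : List Pair
  representatives = concatMap block (upTo (suc k))

  -- The low part in increasing order followed by the high part in
  -- decreasing order is a chain.
  arrangement : Pair → List ℕ
  arrangement (yl , hs) = reverse (toLow yl) ++ hs

  representative : Pair → Word
  representative p = wordOf m k (arrangement p)

  Valid : ℕ → Pair → Set
  Valid j (yl , hs) = j ≤ k × BallotList (lowBound j) j yl × HighList (k ∸ j) hs

  ∈representatives⇒Valid : ∀ {p} → p ∈ representatives → ∃ λ j → Valid j p
  ∈representatives⇒Valid {yl , hs} p∈ with find (∈-concatMap⁻ block {xs = upTo (suc k)} p∈)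
  ... | j , j∈ , p∈block with ∈-cartesianProduct⁻ (ballotLists (lowBound j) j) (highLists (k ∸ j)) p∈block
  ...   | yl∈ , hs∈ = j , ≤-pred (∈-upTo⁻ j∈) , ∈ballotLists⇒BallotList (lowBound j) j yl∈
      , proj₁ (∈highLists⇔HighList (k ∸ j)) hs∈

  Valid⇒∈representatives : 1 ≤ c → ∀ j p → Valid j p → p ∈ representatives
  Valid⇒∈representatives 1≤c j (yl , hs) (j≤k , b , h) =
    ∈-concatMap⁺ block {xs = upTo (suc k)} (Any.map (λ { ≡.refl → p∈block }) (∈-upTo⁺ (s≤s j≤k)))
    where
    p∈block : (yl , hs) ∈ block j
    p∈block = ∈-cartesianProduct⁺ (BallotList⇒∈ballotLists 1≤c (lowBound j) j yl b) (proj₂ (∈highLists⇔HighList (k ∸ j)) h)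

  lowBound+k∸j≤m : k ≤ m → ∀ j → j ≤ k → lowBound j + (k ∸ j) ≤ m
  lowBound+k∸j≤m k≤m j j≤k = begin
    (m ∸ k + j ∸ 1) + (k ∸ j)  ≤⟨ +-monoˡ-≤ (k ∸ j) (m∸n≤m (m ∸ k + j) 1) ⟩
    (m ∸ k + j) + (k ∸ j)      ≡⟨ +-assoc (m ∸ k) j (k ∸ j) ⟩
    (m ∸ k) + (j + (k ∸ j))    ≡⟨ cong ((m ∸ k) +_) (m+[n∸m]≡n j≤k) ⟩
    (m ∸ k) + k                ≡⟨ m∸n+n≡m k≤m ⟩
    m                          ∎
    where open ≤-Reasoning

  length-arrangement : ∀ j p → Valid j p → length (arrangement p) ≡ k
  length-arrangement j (yl , hs) (j≤k , b , h) = begin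
    length (reverse (toLow yl) ++ hs)         ≡⟨ length-++ (reverse (toLow yl)) ⟩
    length (reverse (toLow yl)) + length hs
      ≡⟨ ≡.cong₂ _+_ (≡.trans (length-reverse (toLow yl))
        (≡.trans (length-toLow yl) (length-BallotList _ j yl b)))
                                                             (length-HighList (k ∸ j) hs h) ⟩
    j + (k ∸ j)                               ≡⟨ m+[n∸m]≡n j≤k ⟩
    k                                         ∎
    where open ≡.≡-Reasoning

  module _ (1≤c : 1 ≤ c) where

    Chain-arrangement : k ≤ m → ∀ j p → Valid j p → Chain m k (arrangement p)
    Chain-arrangement k≤m j (yl , hs) (j≤k , b , h) = with-high (k ∸ j) hs h
      where
      R = reverse (toLow yl)
      low-below : ∀ {B} → m ≤ B → Chain B k R
      low-below m≤B = Chain-low 1≤c (lowBound j) j yl b j≤k _ (≤-trans (lowBound+k∸j≤m k≤m j j≤k) m≤B)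
      with-bits : ∀ bs → All (_≤ 1) bs → Chain m k (R ++ toHigh bs)
      with-bits []       _    = Chain-++ R m [] (low-below (n≤1+n m)) ≤-refl
      with-bits (b ∷ bs) bits = Chain-++ R (highTop (b ∷ bs)) (toHigh bs) (low-below (m≤n⇒m≤1+n (m≤highTop (b ∷ bs))))
                                         (proj₂ (Chain-toHigh (b ∷ bs) bits ≤-refl))
      with-high : ∀ r hs → HighList r hs → Chain m k (R ++ hs)
      with-high zero    .[]           ≡.refl              = subst (Chain m k) (≡.sym (++-identityʳ R)) (low-below ≤-refl)
      with-high (suc r) .(toHigh bs) (bs , bs∈ , ≡.refl) = with-bits bs (proj₁ (∈bitLists⇒bits r bs∈))

    AboveMin-arrangement : c * k ≤ m → ∀ j p → Valid j p → AboveMin 0 (arrangement p)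
    AboveMin-arrangement ck≤m j (yl , hs) (j≤k , b , h) =
      AboveMin-++ 0 R hs (AboveMin-low (lowBound j) j yl b)
          (AboveMin-high 1≤c ck≤m (length R) hs ∣R∣+∣hs∣≤k (m≤HighList (k ∸ j) hs h))
      where
      R = reverse (toLow yl)
      ∣R∣+∣hs∣≤k : length R + length hs ≤ k
      ∣R∣+∣hs∣≤k = ≤-reflexive (≡.trans (≡.sym (length-++ R)) (length-arrangement j (yl , hs) (j≤k , b , h)))

    module _ (ck≤m : c * k ≤ m) where

      k≤m : k ≤ m
      k≤m = ≤-trans (m≤n*m k c {{>-nonZero 1≤c}}) ck≤m

      levels-representative : ∀ j p → Valid j p → levels (representative p) ≡ arrangement p
      levels-representative j p v = levels-wordOf-full m k (arrangement p) (length-arrangement j p v)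
          (Chain-arrangement k≤m j p v)

      #U-representative : ∀ j p → Valid j p → #U (representative p) ≡ m
      #U-representative j p v = #U-wordOf-full m k (arrangement p) (length-arrangement j p v) (Chain-arrangement k≤m j p v)

      #D-representative : ∀ j p → Valid j p → #D (representative p) ≡ k
      #D-representative j p v = ≡.trans (#D-wordOf m k (arrangement p)) (length-arrangement j p v)

      InM-representative : ∀ j p → Valid j p → InM c (representative p)
      InM-representative j p v = AboveMin⇒InM (representative p) (#D-representative j p v)
        (subst (AboveMin 0) (≡.sym (levels-representative j p v)) (AboveMin-arrangement ck≤m j p v))

module Covering (c m k : ℕ) where

  open Words
  open LevelSequences
  open Admissibility c k using (minLevel; AboveMin; InM⇒AboveMin)
  open Representatives c m k
  open import Data.Nat using (ℕ; zero; suc; _+_; _*_; _∸_; _≤_; _<_; _≤?_; _<?_; s≤s; z≤n; pred; >-nonZero)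
  open import Data.Nat.Properties
  open import Data.List using (List; []; _∷_; _++_; length; filter; reverse)
  open import Data.List.Properties using (length-++; filter-none; filter-all; filter-accept; filter-reject)
  open import Data.List.Membership.Propositional using (_∈_)
  open import Data.List.Membership.Propositional.Properties using (∈-filter⁺; ∈-filter⁻)
  open import Data.List.Relation.Unary.All as All using (All; []; _∷_)
  open import Data.List.Relation.Unary.All.Properties using (all-filter)
  open import Data.List.Relation.Unary.Any using (here; there)
  open import Data.List.Relation.Binary.Permutation.Propositional using (_↭_; refl; prep; swap; ↭-sym; ↭-trans)
  open import Data.List.Relation.Binary.Permutation.Propositional.Properties using
      (↭-length; ∈-resp-↭; All-resp-↭; filter-↭; shift; ++⁺; ++⁺ʳ; ↭-reverse)
  open import Data.Product using (∃; ∃₂; _×_; _,_; proj₁; proj₂)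
  open import Data.Sum using (inj₁; inj₂)
  open import Relation.Nullary using (yes; no; contradiction)
  open import Relation.Binary.PropositionalEquality as ≡ using (_≡_; cong; subst; subst₂)

  countBelow : ℕ → List ℕ → ℕ
  countBelow t xs = length (filter (_<? t) xs)

  countBelow-∷-≤ : ∀ t x xs → countBelow t (x ∷ xs) ≤ suc (countBelow t xs)
  countBelow-∷-≤ t x xs with x <? t
  ... | yes x<t = ≤-reflexive (cong length (filter-accept (_<? t) x<t))
  ... | no  x≮t = ≤-trans (≤-reflexive (cong length (filter-reject (_<? t) x≮t))) (n≤1+n _)

  countBelow-∷-≥ : ∀ t x xs → countBelow t xs ≤ countBelow t (x ∷ xs)
  countBelow-∷-≥ t x xs with x <? t
  ... | yes x<t = ≤-trans (n≤1+n _) (≤-reflexive (cong length (≡.sym (filter-accept (_<? t) x<t))))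
  ... | no  x≮t = ≤-reflexive (cong length (≡.sym (filter-reject (_<? t) x≮t)))

  countBelow-↭ : ∀ t {xs ys} → xs ↭ ys → countBelow t xs ≡ countBelow t ys
  countBelow-↭ t xs↭ys = ↭-length (filter-↭ (_<? t) xs↭ys)

  max-above : ∀ t x rest → All (_≤ x) rest → countBelow t (x ∷ rest) ≤ length rest → t ≤ x
  max-above t x rest rest≤x few with t ≤? x
  ... | yes t≤x = t≤x
  ... | no  t≰x = contradiction few (<⇒≱ (≤-reflexive (≡.sym (cong length (filter-all (_<? t) (x<t ∷ rest<t))))))
    where
    x<t = ≰⇒> t≰x
    rest<t = All.map (λ z≤x → ≤-<-trans z≤x x<t) rest≤x

  module _ (1≤c : 1 ≤ c) where

    minLevel-suc : ∀ i → minLevel i ≤ minLevel (suc i)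
    minLevel-suc i = begin
      c * suc i + (k ∸ suc i)               ≤⟨ +-monoʳ-≤ (c * suc i) (∸-suc≤ k (suc i)) ⟩
      c * suc i + suc (k ∸ suc (suc i))     ≡⟨ +-suc _ _ ⟩
      suc (c * suc i) + (k ∸ suc (suc i))   ≤⟨ +-monoˡ-≤ _ (+-monoˡ-≤ (c * suc i) 1≤c) ⟩
      c + c * suc i + (k ∸ suc (suc i))     ≡⟨ cong (_+ (k ∸ suc (suc i))) (*-suc c (suc i)) ⟨
      c * suc (suc i) + (k ∸ suc (suc i))   ∎
      where
      open ≤-Reasoning
      ∸-suc≤ : ∀ n i → n ∸ i ≤ suc (n ∸ suc i)
      ∸-suc≤ zero    i       = subst (_≤ suc (0 ∸ suc i)) (≡.sym (0∸n≡0 i)) z≤n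
      ∸-suc≤ (suc n) zero    = ≤-refl
      ∸-suc≤ (suc n) (suc i) = ∸-suc≤ n i

    AboveMin⇒All : ∀ i zs → AboveMin i zs → All (minLevel i ≤_) zs
    AboveMin⇒All i []       _       = []
    AboveMin⇒All i (z ∷ zs) (h , a) = h ∷ All.map (≤-trans (minLevel-suc i)) (AboveMin⇒All (suc i) zs a)

    countBelow-AboveMin : ∀ i zs i₀ → AboveMin i zs → i ≤ i₀ → countBelow (minLevel i₀) zs ≤ i₀ ∸ i
    countBelow-AboveMin i []       i₀ _       _    = z≤n
    countBelow-AboveMin i (z ∷ zs) i₀ (h , a) i≤i₀ with m≤n⇒m<n∨m≡n i≤i₀
    ... | inj₂ ≡.refl = ≤-reflexive
        (≡.trans (cong length (filter-none (_<? minLevel i) (All.map ≤⇒≯ (AboveMin⇒All i (z ∷ zs) (h , a)))))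
            (≡.sym (n∸n≡0 i)))
    ... | inj₁ i<i₀   = ≤-trans (countBelow-∷-≤ (minLevel i₀) z zs)
                                (subst (suc (countBelow (minLevel i₀) zs) ≤_) (≡.sym (+-∸-assoc 1 i<i₀))
                                       (s≤s (countBelow-AboveMin (suc i) zs i₀ a i<i₀)))

  low high : List ℕ → List ℕ
  low  = filter (_<? m)
  high = filter (m ≤?_)

  low++high-↭ : ∀ xs → xs ↭ low xs ++ high xs
  low++high-↭ []       = refl
  low++high-↭ (x ∷ xs) with x <? m
  ... | yes x<m = subst (x ∷ xs ↭_) (≡.sym (≡.cong₂ _++_ (filter-accept (_<? m) x<m) (filter-reject (m ≤?_) (<⇒≱ x<m))))
                        (prep x (low++high-↭ xs))
  ... | no  x≮m = subst (x ∷ xs ↭_) (≡.sym (≡.cong₂ _++_ (filter-reject (_<? m) x≮m) (filter-accept (m ≤?_) (≮⇒≥ x≮m))))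
                        (↭-trans (prep x (low++high-↭ xs)) (↭-sym (shift x (low xs) (high xs))))

  countBelow-low : ∀ t xs → t ≤ m → countBelow t (low xs) ≡ countBelow t xs
  countBelow-low t []       _   = ≡.refl
  countBelow-low t (x ∷ xs) t≤m with x <? m | x <? t
  ... | yes x<m | yes x<t = ≡.trans (cong (countBelow t) (filter-accept (_<? m) x<m))
                              (≡.trans (cong length (filter-accept (_<? t) x<t))
                                (≡.trans (cong suc (countBelow-low t xs t≤m))
                                    (≡.sym (cong length (filter-accept (_<? t) x<t)))))
  ... | yes x<m | no  x≮t = ≡.trans (cong (countBelow t) (filter-accept (_<? m) x<m))
                              (≡.trans (cong length (filter-reject (_<? t) x≮t))
                                (≡.trans (countBelow-low t xs t≤m) (≡.sym (cong length (filter-reject (_<? t) x≮t)))))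
  ... | no  x≮m | yes x<t = contradiction (<-≤-trans x<t t≤m) x≮m
  ... | no  x≮m | no  x≮t = ≡.trans (cong (countBelow t) (filter-reject (_<? m) x≮m))
                              (≡.trans (countBelow-low t xs t≤m) (≡.sym (cong length (filter-reject (_<? t) x≮t))))

  maxOut : ∀ x xs → ∃₂ λ y rest → x ∷ xs ↭ y ∷ rest × All (_≤ y) rest
  maxOut x []        = x , [] , refl , []
  maxOut x (x′ ∷ xs) with maxOut x′ xs
  ... | y , rest , ↭y∷rest , rest≤y with x ≤? y
  ...   | yes x≤y = y , x ∷ rest , ↭-trans (prep x ↭y∷rest) (swap x y refl) , x≤y ∷ rest≤y
  ...   | no  x≰y = x , y ∷ rest , prep x ↭y∷rest , y≤x ∷ All.map (λ z≤y → ≤-trans z≤y y≤x) rest≤y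
    where y≤x = <⇒≤ (≰⇒> x≰y)

  module _ (1≤c : 1 ≤ c) where

    -- The largest element x of S becomes the head y = x ∸ (k ∸ suc j) of the ballot list.
    lowPart-ballot : ∀ j N S → length S ≡ j → j ≤ k → All (λ x → x + j ≤ N + k) S →
                     (∀ i → i < j → countBelow (minLevel i) S ≤ i) → ∃ λ yl → BallotList N j yl × toLow yl ↭ S
    lowPart-ballot zero    N []        _    _   _     _      = [] , _ , refl
    lowPart-ballot (suc j) N (x₀ ∷ xs) ∣S∣≡ j<k bound ballot with maxOut x₀ xs
    ... | x , rest , S↭ , rest≤x = y ∷ yl , (cj≤y , y≤N , b) , perm
      where
      K = k ∸ suc j
      ∣rest∣≡j : length rest ≡ j
      ∣rest∣≡j = suc-injective (≡.trans (≡.sym (↭-length S↭)) ∣S∣≡)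
      x-above : minLevel j ≤ x
      x-above = max-above (minLevel j) x rest rest≤x
                  (subst₂ _≤_ (countBelow-↭ (minLevel j) S↭) (≡.sym ∣rest∣≡j) (ballot j ≤-refl))
      y = x ∸ K
      y+K≡x : y + K ≡ x
      y+K≡x = m∸n+n≡m (≤-trans (m≤n+m K (c * suc j)) x-above)
      cj≤y : c * suc j ≤ y
      cj≤y = +-cancelʳ-≤ K _ _ (subst (minLevel j ≤_) (≡.sym y+K≡x) x-above)
      K+1+j≡k : K + suc j ≡ k
      K+1+j≡k = m∸n+n≡m j<k
      y≤N : y ≤ N
      y≤N = +-cancelʳ-≤ (K + suc j) _ _ (subst₂ _≤_ (≡.trans (cong (_+ suc j) (≡.sym y+K≡x)) (+-assoc y K (suc j)))
                                                    (cong (N +_) (≡.sym K+1+j≡k))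
                                                    (All.lookup bound (∈-resp-↭ (↭-sym S↭) (here ≡.refl))))
      pred-y+k≡x+j : pred y + k ≡ x + j
      pred-y+k≡x+j = begin
        pred y + k                 ≡⟨ cong (pred y +_) (≡.trans (≡.sym K+1+j≡k) (+-suc K j)) ⟩
        pred y + suc (K + j)       ≡⟨ +-suc (pred y) _ ⟩
        suc (pred y) + (K + j)     ≡⟨ cong (_+ (K + j)) (suc-pred y {{>-nonZero (1≤ballot 1≤c cj≤y)}}) ⟩
        y + (K + j)                ≡⟨ +-assoc y K j ⟨
        y + K + j                  ≡⟨ cong (_+ j) y+K≡x ⟩
        x + j                      ∎
        where open ≡.≡-Reasoning
      bound′ : All (λ x′ → x′ + j ≤ pred y + k) rest
      bound′ = All.map (λ {x′} x′≤x → subst (x′ + j ≤_) (≡.sym pred-y+k≡x+j) (+-monoˡ-≤ j x′≤x)) rest≤x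
      ballot′ : ∀ i → i < j → countBelow (minLevel i) rest ≤ i
      ballot′ i i<j = ≤-trans (countBelow-∷-≥ (minLevel i) x rest)
                              (subst (_≤ i) (countBelow-↭ (minLevel i) S↭) (ballot i (m<n⇒m<1+n i<j)))
      recursive = lowPart-ballot j (pred y) rest ∣rest∣≡j (<⇒≤ j<k) bound′ ballot′
      yl = proj₁ recursive
      b = proj₁ (proj₂ recursive)
      head≡x : y + (k ∸ suc (length yl)) ≡ x
      head≡x = ≡.trans (cong (λ n → y + (k ∸ suc n)) (length-BallotList (pred y) j yl b)) y+K≡x
      perm : toLow (y ∷ yl) ↭ x₀ ∷ xs
      perm = subst (λ h → h ∷ toLow yl ↭ x₀ ∷ xs) (≡.sym head≡x) (↭-trans (prep x (proj₂ (proj₂ recursive))) (↭-sym S↭))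

  highTop∈toHigh : ∀ bs → highTop bs ∈ toHigh bs
  highTop∈toHigh []       = here ≡.refl
  highTop∈toHigh (b ∷ bs) = here ≡.refl

  Closed : List ℕ → Set
  Closed S = ∀ {x z} → x ∈ S → m ≤ z → z ≤ x → z ∈ S

  gap≤1 : ∀ {S x rest x′} → All (m ≤_) S → Closed S → S ↭ x ∷ rest → x′ ∈ rest → All (_≤ x′) rest → x ≤ suc x′
  gap≤1 {S} {x} {rest} {x′} m≤S closed S↭ x′∈rest rest≤x′ with m <? x
  ... | no  m≮x = ≤-trans (≮⇒≥ m≮x) (≤-trans (All.lookup m≤S (∈-resp-↭ (↭-sym S↭) (there x′∈rest))) (n≤1+n x′))
  ... | yes m<x = subst (_≤ suc x′) 1+pred-x≡x (s≤s (All.lookup rest≤x′ pred-x∈rest))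
    where
    1+pred-x≡x : suc (pred x) ≡ x
    1+pred-x≡x = suc-pred x {{>-nonZero (≤-<-trans z≤n m<x)}}
    m≤pred-x : m ≤ pred x
    m≤pred-x = ≤-pred (subst (suc m ≤_) (≡.sym 1+pred-x≡x) m<x)
    pred-x∈rest : pred x ∈ rest
    pred-x∈rest with ∈-resp-↭ S↭ (closed (∈-resp-↭ (↭-sym S↭) (here ≡.refl)) m≤pred-x pred[n]≤n)
    ... | there p∈ = p∈
    ... | here p≡x = contradiction p≡x (<⇒≢ (subst (pred x <_) 1+pred-x≡x ≤-refl))

  -- The largest element x of S becomes the head x ∸ x′ of the bit list, x′ the top of the rest.
  highPart-bits : ∀ r S → length S ≡ suc r → All (m ≤_) S → Closed S → ∃ λ bs → bs ∈ bitLists r × toHigh bs ↭ S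
  highPart-bits r (s₀ ∷ ss) ∣S∣≡ m≤S closed with maxOut s₀ ss
  highPart-bits zero (s₀ ∷ ss) ∣S∣≡ m≤S closed | x , [] , S↭ , _ =
    [] , here ≡.refl , subst (λ h → h ∷ [] ↭ s₀ ∷ ss) (≡.sym m≡x) (↭-sym S↭)
    where
    x∈S = ∈-resp-↭ (↭-sym S↭) (here ≡.refl)
    m≡x : m ≡ x
    m≡x with ∈-resp-↭ S↭ (closed x∈S ≤-refl (All.lookup m≤S x∈S))
    ... | here m≡x = m≡x
  highPart-bits zero (s₀ ∷ ss) ∣S∣≡ m≤S closed | x , _ ∷ _ , S↭ , _ with () ← ≡.trans (≡.sym (↭-length S↭)) ∣S∣≡
  highPart-bits (suc r) (s₀ ∷ ss) ∣S∣≡ m≤S closed | x , rest , S↭ , rest≤x =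
    x ∸ x′ ∷ bs′ , bit∈bitLists r b≤1 bs′∈ , subst (λ h → h ∷ toHigh bs′ ↭ s₀ ∷ ss) (≡.sym b+x′≡x) (↭-trans (prep x toHigh↭rest) (↭-sym S↭))
    where
    rest⊆S : ∀ {z} → z ∈ rest → z ∈ s₀ ∷ ss
    rest⊆S z∈ = ∈-resp-↭ (↭-sym S↭) (there z∈)
    m≤rest : All (m ≤_) rest
    m≤rest = All.tabulate (λ z∈ → All.lookup m≤S (rest⊆S z∈))
    closed′ : Closed rest
    closed′ {x′} x′∈ m≤z z≤x′ with ∈-resp-↭ S↭ (closed (rest⊆S x′∈) m≤z z≤x′)
    ... | there z∈rest = z∈rest
    ... | here ≡.refl  = subst (_∈ rest) (≤-antisym (All.lookup rest≤x x′∈) z≤x′) x′∈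
    recursive = highPart-bits r rest (suc-injective (≡.trans (≡.sym (↭-length S↭)) ∣S∣≡)) m≤rest closed′
    bs′ = proj₁ recursive
    bs′∈ = proj₁ (proj₂ recursive)
    toHigh↭rest = proj₂ (proj₂ recursive)
    x′ = highTop bs′
    x′∈rest : x′ ∈ rest
    x′∈rest = ∈-resp-↭ toHigh↭rest (highTop∈toHigh bs′)
    b+x′≡x : x ∸ x′ + x′ ≡ x
    b+x′≡x = m∸n+n≡m (All.lookup rest≤x x′∈rest)
    b≤1 : x ∸ x′ ≤ 1
    b≤1 = subst (x ∸ x′ ≤_) (m+n∸n≡m 1 x′)
            (∸-monoˡ-≤ x′ (gap≤1 m≤S closed S↭ x′∈rest (All-resp-↭ toHigh↭rest (toHigh≤highTop bs′))))

  lowBound-bound : k ≤ m → ∀ xs → All (_< m) xs → All (λ x → x + length xs ≤ lowBound (length xs) + k) xs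
  lowBound-bound k≤m []       _   = []
  lowBound-bound k≤m (_ ∷ xs) x<m = All.map
      (λ {x} x<m → subst (x + suc j ≤_) (≡.sym lowBound+k)
          (subst (_≤ m + j) (≡.sym (+-suc x j)) (+-monoˡ-≤ j x<m))) x<m
    where
    j = length xs
    lowBound+k : lowBound (suc j) + k ≡ m + j
    lowBound+k = begin
      (m ∸ k + suc j ∸ 1) + k   ≡⟨ cong (λ n → n ∸ 1 + k) (+-suc (m ∸ k) j) ⟩
      (m ∸ k + j) + k           ≡⟨ +-assoc (m ∸ k) j k ⟩
      (m ∸ k) + (j + k)         ≡⟨ cong ((m ∸ k) +_) (+-comm j k) ⟩
      (m ∸ k) + (k + j)         ≡⟨ +-assoc (m ∸ k) k j ⟨
      (m ∸ k) + k + j           ≡⟨ cong (_+ j) (m∸n+n≡m k≤m) ⟩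
      m + j                     ∎
      where open ≡.≡-Reasoning

  covered : 1 ≤ c → c * k ≤ m → ∀ w → InM c w → #D w ≡ k → #U w ≡ m → ∃₂ λ j p → Valid j p × arrangement p ↭ levels w
  covered 1≤c ck≤m w inM #Dw≡k #Uw≡m = j , (yl , hs) , (j≤k , b , h) , perm
    where
    zs = levels w
    chain : Chain m k zs
    chain = subst₂ (λ M p → Chain M p zs) #Uw≡m #Dw≡k (Chain-levels w)
    L = low zs
    H = high zs
    j = length L
    ∣L∣+∣H∣≡k : j + length H ≡ k
    ∣L∣+∣H∣≡k = ≡.trans (≡.sym (length-++ L)) (≡.trans (≡.sym (↭-length (low++high-↭ zs))) (≡.trans (length-levels w) #Dw≡k))
    j≤k : j ≤ k
    j≤k = subst (j ≤_) ∣L∣+∣H∣≡k (m≤m+n j _)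
    ballot : ∀ i → i < j → countBelow (minLevel i) L ≤ i
    ballot i i<j = subst (_≤ i) (≡.sym (countBelow-low _ zs (≤-trans (minLevel≤ck 1≤c i (<-≤-trans i<j j≤k)) ck≤m)))
                         (countBelow-AboveMin 1≤c 0 zs i (InM⇒AboveMin w #Dw≡k inM) z≤n)
    lowR = lowPart-ballot 1≤c j (lowBound j) L ≡.refl j≤k (lowBound-bound (k≤m 1≤c ck≤m) L (all-filter (_<? m) zs)) ballot
    yl = proj₁ lowR
    b = proj₁ (proj₂ lowR)
    closed : Closed H
    closed x∈H m≤z z≤x = ∈-filter⁺ (m ≤?_) (Chain-between zs chain (proj₁ (∈-filter⁻ (m ≤?_) x∈H)) m≤z z≤x) m≤z
    highR : ∀ r → length H ≡ r → ∃ λ hs → HighList r hs × hs ↭ H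
    highR zero    ∣H∣≡0 with [] ← H = [] , ≡.refl , refl
    highR (suc r) ∣H∣≡r with highPart-bits r H ∣H∣≡r (all-filter (m ≤?_) zs) closed
    ... | bs , bs∈ , toHigh↭H = toHigh bs , (bs , bs∈ , ≡.refl) , toHigh↭H
    hsR = highR (k ∸ j) (≡.trans (≡.sym (m+n∸m≡n j (length H))) (cong (_∸ j) ∣L∣+∣H∣≡k))
    hs = proj₁ hsR
    h = proj₁ (proj₂ hsR)
    perm : reverse (toLow yl) ++ hs ↭ zs
    perm = ↭-trans (++⁺ʳ hs (↭-reverse (toLow yl)))
        (↭-trans (++⁺ (proj₂ (proj₂ lowR)) (proj₂ (proj₂ hsR))) (↭-sym (low++high-↭ zs)))

module Distinctness (c m k : ℕ) where

  open Words
  open Representatives c m k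
  open import Data.Nat using (ℕ; zero; suc; _+_; _*_; _∸_; _≤_; _<_; _≥_; _≟_; _≤?_; pred)
  open import Data.Nat.Properties
  open import Data.List using ([]; _∷_; map; length; reverse; upTo)
  open import Data.List.Properties as List using (∷-injectiveˡ; ∷-injectiveʳ; filter-none; filter-some)
  open import Data.List.Membership.Propositional using (_∈_)
  open import Data.List.Membership.Propositional.Properties using (∈-map⁻; ∈-cartesianProduct⁻)
  open import Data.List.Relation.Unary.All as All using (All; []; _∷_)
  open import Data.List.Relation.Unary.Any as Any using (here; there)
  open import Data.List.Relation.Unary.AllPairs using (AllPairs; []; _∷_)
  open import Data.List.Relation.Unary.Unique.Propositional using (Unique)
  import Data.List.Relation.Unary.Unique.Propositional.Properties as Unique
  open import Data.List.Relation.Binary.Disjoint.Propositional using (Disjoint)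
  open import Data.List.Relation.Binary.Permutation.Propositional.Properties using (↭-reverse)
  open import Data.Product using (∃; _×_; _,_; proj₁; proj₂)
  open import Data.Sum as Sum using (_⊎_; inj₁; inj₂; [_,_])
  open import Relation.Nullary using (yes; no; contradiction)
  open import Relation.Binary.Definitions using (tri<; tri≈; tri>)
  open import Relation.Binary.PropositionalEquality as ≡ using (_≡_; _≢_; cong)
  open import Function using (_∘_)

  multiplicity-∈ : ∀ t xs → t ∈ xs → 0 < multiplicity t xs
  multiplicity-∈ t xs t∈xs = filter-some (_≟ t) (Any.map ≡.sym t∈xs)

  multiplicity-∉ : ∀ t xs → All (_≢ t) xs → multiplicity t xs ≡ 0
  multiplicity-∉ t xs x≢t = cong length (filter-none (_≟ t) x≢t)

  multiplicity-∷-cancel : ∀ t x xs ys → multiplicity t (x ∷ xs) ≡ multiplicity t (x ∷ ys) →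
      multiplicity t xs ≡ multiplicity t ys
  multiplicity-∷-cancel t x xs ys e =
    +-cancelˡ-≡ (multiplicity t (x ∷ [])) _ _
        (≡.trans (≡.sym (multiplicity-++ t (x ∷ []) xs)) (≡.trans e (multiplicity-++ t (x ∷ []) ys)))

  sorted-multiplicity : ∀ xs ys → AllPairs _≥_ xs → AllPairs _≥_ ys → xs ≢ ys →
                        ∃ λ t → (t ∈ xs ⊎ t ∈ ys) × multiplicity t xs ≢ multiplicity t ys
  sorted-multiplicity []       []       _ _ xs≢ys = contradiction ≡.refl xs≢ys
  sorted-multiplicity []       (y ∷ ys) _ _ _ = y , inj₂ (here ≡.refl) , <⇒≢ (multiplicity-∈ y (y ∷ ys) (here ≡.refl))
  sorted-multiplicity (x ∷ xs) []       _ _ _ = x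
      , inj₁ (here ≡.refl) , ≡.≢-sym (<⇒≢ (multiplicity-∈ x (x ∷ xs) (here ≡.refl)))
  sorted-multiplicity (x ∷ xs) (y ∷ ys) (x≥xs ∷ sxs) (y≥ys ∷ sys) x∷xs≢y∷ys with <-cmp x y
  ... | tri≈ _ ≡.refl _ =
    let t , t∈ , ≢ = sorted-multiplicity xs ys sxs sys (λ xs≡ys → x∷xs≢y∷ys (cong (x ∷_) xs≡ys))
    in  t , Sum.map there there t∈ , λ e → ≢ (multiplicity-∷-cancel t x xs ys e)
  ... | tri< x<y _ _ = y , inj₂ (here ≡.refl) , λ e → <⇒≢ (multiplicity-∈ y (y ∷ ys) (here ≡.refl))
                          (≡.trans (≡.sym (multiplicity-∉ y (x ∷ xs)
                              (<⇒≢ x<y ∷ All.map (λ z≤x → <⇒≢ (≤-<-trans z≤x x<y)) x≥xs))) e)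
  ... | tri> _ _ y<x = x , inj₁ (here ≡.refl) , λ e → <⇒≢ (multiplicity-∈ x (x ∷ xs) (here ≡.refl))
                          (≡.trans (≡.sym (multiplicity-∉ x (y ∷ ys)
                              (<⇒≢ y<x ∷ All.map (λ z≤y → <⇒≢ (≤-<-trans z≤y y<x)) y≥ys))) (≡.sym e))

  toLow-injective : ∀ as bs → toLow as ≡ toLow bs → as ≡ bs
  toLow-injective []       []       _ = ≡.refl
  toLow-injective (a ∷ as) (b ∷ bs) e = ≡.cong₂ _∷_ a≡b as≡bs
    where
    as≡bs = toLow-injective as bs (∷-injectiveʳ e)
    a≡b = +-cancelʳ-≡ (k ∸ suc (length as)) a b
        (≡.trans (∷-injectiveˡ e) (cong (λ l → b + (k ∸ suc (length l))) (≡.sym as≡bs)))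

  toHigh≢[] : ∀ bs → toHigh bs ≢ []
  toHigh≢[] []      ()
  toHigh≢[] (_ ∷ _) ()

  toHigh-injective : ∀ as bs → toHigh as ≡ toHigh bs → as ≡ bs
  toHigh-injective []       []       _ = ≡.refl
  toHigh-injective []       (b ∷ bs) e = contradiction (≡.sym (∷-injectiveʳ e)) (toHigh≢[] bs)
  toHigh-injective (a ∷ as) []       e = contradiction (∷-injectiveʳ e) (toHigh≢[] as)
  toHigh-injective (a ∷ as) (b ∷ bs) e = ≡.cong₂ _∷_ a≡b as≡bs
    where
    as≡bs = toHigh-injective as bs (∷-injectiveʳ e)
    a≡b = +-cancelʳ-≡ (highTop as) a b (≡.trans (∷-injectiveˡ e) (cong (λ l → b + highTop l) (≡.sym as≡bs)))

  toHigh-decreasing : ∀ bs → AllPairs _≥_ (toHigh bs)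
  toHigh-decreasing []       = [] ∷ []
  toHigh-decreasing (b ∷ bs) = All.map (λ h → ≤-trans h (m≤n+m _ b)) (toHigh≤highTop bs) ∷ toHigh-decreasing bs

  HighList-decreasing : ∀ r hs → HighList r hs → AllPairs _≥_ hs
  HighList-decreasing zero    .[]           ≡.refl           = []
  HighList-decreasing (suc r) .(toHigh bs) (bs , _ , ≡.refl) = toHigh-decreasing bs

  multiplicity-arrangement : ∀ t yl hs →
      multiplicity t (arrangement (yl , hs)) ≡ multiplicity t (toLow yl) + multiplicity t hs
  multiplicity-arrangement t yl hs =
    ≡.trans (multiplicity-++ t (reverse (toLow yl)) hs)
        (cong (_+ multiplicity t hs) (multiplicity-↭ t (↭-reverse (toLow yl))))

  multiplicity-arrangement-low : ∀ {t} yl r hs → t < m → HighList r hs →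
                                 multiplicity t (arrangement (yl , hs)) ≡ multiplicity t (toLow yl)
  multiplicity-arrangement-low {t} yl r hs t<m h = begin
    multiplicity t (arrangement (yl , hs))            ≡⟨ multiplicity-arrangement t yl hs ⟩
    multiplicity t (toLow yl) + multiplicity t hs     ≡⟨ cong (_ +_) absent ⟩
    multiplicity t (toLow yl) + 0                     ≡⟨ +-identityʳ _ ⟩
    multiplicity t (toLow yl)                         ∎
    where
    open ≡.≡-Reasoning
    absent = multiplicity-∉ t hs (All.map (λ m≤x x≡t → <⇒≱ t<m (≡.subst (m ≤_) x≡t m≤x)) (m≤HighList r hs h))

  multiplicity-arrangement-high : ∀ {t} yl hs → m ≤ t → All (_< m) (toLow yl) →
                                  multiplicity t (arrangement (yl , hs)) ≡ multiplicity t hs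
  multiplicity-arrangement-high {t} yl hs m≤t low<m =
    ≡.trans (multiplicity-arrangement t yl hs) (cong (_+ _) absent)
    where
    absent = multiplicity-∉ t (toLow yl) (All.map (λ x<m x≡t → <⇒≱ x<m (≡.subst (m ≤_) (≡.sym x≡t) m≤t)) low<m)

  module _ (1≤c : 1 ≤ c) where

    toLow-decreasing : ∀ N j yl → BallotList N j yl → j ≤ k → AllPairs _≥_ (toLow yl)
    toLow-decreasing N zero    []       _                 _   = []
    toLow-decreasing N (suc j) (y ∷ yl) (cj≤y , _ , b) j<k rewrite length-BallotList (pred y) j yl b =
      All.map (λ x≤ → ≤-trans x≤ (≤-reflexive (pred-shift 1≤c j<k cj≤y))) (toLow-bound 1≤c (pred y) j yl b (<⇒≤ j<k)) ∷
      toLow-decreasing (pred y) j yl b (<⇒≤ j<k)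

    toLow<m : k ≤ m → ∀ j yl → BallotList (lowBound j) j yl → j ≤ k → All (_< m) (toLow yl)
    toLow<m k≤m zero    []       _ _   = []
    toLow<m k≤m (suc j) (y ∷ yl) b j<k = All.map (λ x≤ → ≤-<-trans x≤ (≤-reflexive top<m))
        (toLow-bound 1≤c _ (suc j) (y ∷ yl) b j<k)
      where
      top<m : suc (lowBound (suc j) + (k ∸ suc j)) ≡ m
      top<m = begin
        suc (m ∸ k + suc j ∸ 1 + (k ∸ suc j))   ≡⟨ cong (λ n → suc (n ∸ 1 + (k ∸ suc j))) (+-suc (m ∸ k) j) ⟩
        suc (m ∸ k + j + (k ∸ suc j))           ≡⟨ +-suc (m ∸ k + j) _ ⟨
        m ∸ k + j + suc (k ∸ suc j)             ≡⟨ cong (m ∸ k + j +_) (+-∸-assoc 1 j<k) ⟨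
        m ∸ k + j + (k ∸ j)                     ≡⟨ +-assoc (m ∸ k) j _ ⟩
        m ∸ k + (j + (k ∸ j))                   ≡⟨ cong (m ∸ k +_) (m+[n∸m]≡n (<⇒≤ j<k)) ⟩
        m ∸ k + k                               ≡⟨ m∸n+n≡m k≤m ⟩
        m                                       ∎
        where open ≡.≡-Reasoning

    -- Low levels lie below m and high levels from m on, so a difference in
    -- either part shows up in the multiplicities.
    distinct-multiplicity : k ≤ m → ∀ {j j′ p q} → Valid j p → Valid j′ q → p ≢ q →
                            ∃ λ t → multiplicity t (arrangement p) ≢ multiplicity t (arrangement q)
    distinct-multiplicity k≤m {j} {j′} {yl₁ , hs₁} {yl₂ , hs₂} (j≤k , b₁ , h₁) (j′≤k , b₂ , h₂) p≢q
      with List.≡-dec _≟_ yl₁ yl₂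
    ... | no yl₁≢yl₂ with sorted-multiplicity (toLow yl₁) (toLow yl₂) (toLow-decreasing _ j yl₁ b₁ j≤k)
                            (toLow-decreasing _ j′ yl₂ b₂ j′≤k) (yl₁≢yl₂ ∘ toLow-injective yl₁ yl₂)
    ...   | t , t∈ , differ = t , λ e → differ (≡.trans (≡.sym (multiplicity-arrangement-low yl₁ _ hs₁ t<m h₁))
                                                  (≡.trans e (multiplicity-arrangement-low yl₂ _ hs₂ t<m h₂)))
      where
      t<m = [ All.lookup (toLow<m k≤m j yl₁ b₁ j≤k) , All.lookup (toLow<m k≤m j′ yl₂ b₂ j′≤k) ] t∈
    distinct-multiplicity k≤m {j} {j′} {yl , hs₁} {yl , hs₂} (j≤k , b , h₁) (_ , _ , h₂) p≢q
      | yes ≡.refl with sorted-multiplicity hs₁ hs₂ (HighList-decreasing _ hs₁ h₁) (HighList-decreasing _ hs₂ h₂) (p≢q ∘ cong (yl ,_))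
    ...   | t , t∈ , differ = t , λ e → differ (≡.trans (≡.sym (multiplicity-arrangement-high yl hs₁ m≤t low<m))
                                                  (≡.trans e (multiplicity-arrangement-high yl hs₂ m≤t low<m)))
      where
      m≤t = [ All.lookup (m≤HighList _ hs₁ h₁) , All.lookup (m≤HighList _ hs₂ h₂) ] t∈
      low<m = toLow<m k≤m j yl b j≤k

  unique-ballotLists : ∀ N j → Unique (ballotLists N j)
  unique-ballotLists N       zero    = [] ∷ []
  unique-ballotLists zero    (suc j) = []
  unique-ballotLists (suc N) (suc j) with c * suc j ≤? suc N
  ... | no  _ = unique-ballotLists N (suc j)
  ... | yes _ = Unique.++⁺ (unique-ballotLists N (suc j)) (Unique.map⁺ ∷-injectiveʳ (unique-ballotLists N j)) disjoint
    where
    disjoint : Disjoint (ballotLists N (suc j)) (map (suc N ∷_) (ballotLists N j))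
    disjoint (yl∈ , yl∈′) with ∈-map⁻ (suc N ∷_) yl∈′
    ... | _ , _ , ≡.refl = <⇒≱ ≤-refl (proj₁ (proj₂ (∈ballotLists⇒BallotList N (suc j) yl∈)))

  unique-bitLists : ∀ r → Unique (bitLists r)
  unique-bitLists zero    = [] ∷ []
  unique-bitLists (suc r) = Unique.++⁺ (Unique.map⁺ ∷-injectiveʳ (unique-bitLists r))
      (Unique.map⁺ ∷-injectiveʳ (unique-bitLists r)) disjoint
    where
    disjoint : Disjoint (map (0 ∷_) (bitLists r)) (map (1 ∷_) (bitLists r))
    disjoint (bs∈₀ , bs∈₁) with ∈-map⁻ (0 ∷_) bs∈₀ | ∈-map⁻ (1 ∷_) bs∈₁
    ... | _ , _ , ≡.refl | _ , _ , ()

  unique-highLists : ∀ r → Unique (highLists r)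
  unique-highLists zero    = [] ∷ []
  unique-highLists (suc r) = Unique.map⁺ (toHigh-injective _ _) (unique-bitLists r)

  unique-representatives : Unique representatives
  unique-representatives = Unique.concat⁺ (All.tabulate λ {bl} bl∈ → unique-block bl∈)
      (disjoint-blocks (upTo (suc k)) (Unique.upTo⁺ (suc k)))
    where
    unique-block : ∀ {bl} → bl ∈ map block (upTo (suc k)) → Unique bl
    unique-block bl∈ with ∈-map⁻ block {xs = upTo (suc k)} bl∈
    ... | j , _ , ≡.refl = Unique.cartesianProduct⁺ (unique-ballotLists (lowBound j) j) (unique-highLists (k ∸ j))
    length-low : ∀ {j p} → p ∈ block j → length (proj₁ p) ≡ j
    length-low {j} p∈ = length-BallotList _ j _ (∈ballotLists⇒BallotList _ j (proj₁ (∈-cartesianProduct⁻ _ _ p∈)))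
    disjoint-blocks : ∀ js → Unique js → AllPairs Disjoint (map block js)
    disjoint-blocks []       []             = []
    disjoint-blocks (j ∷ js) (j∉js ∷ ujs) = disjoint-from js j∉js ∷ disjoint-blocks js ujs
      where
      disjoint-from : ∀ js → All (j ≢_) js → All (Disjoint (block j)) (map block js)
      disjoint-from []        []            = []
      disjoint-from (j′ ∷ js) (j≢j′ ∷ j∉js) = (λ (p∈ , p∈′) → j≢j′
          (≡.trans (≡.sym (length-low p∈)) (length-low p∈′))) ∷ disjoint-from js j∉js

  AllPairs-weaken : ∀ {q r s} {A : Set} {Q : A → Set q} {R : A → A → Set r} {S : A → A → Set s} {xs} →
                    (∀ {x y} → Q x → Q y → R x y → S x y) → All Q xs → AllPairs R xs → AllPairs S xs
  AllPairs-weaken f []       []         = []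
  AllPairs-weaken f (q ∷ qs) (rs ∷ rss) = All.zipWith (λ (q′ , r) → f q q′ r) (qs , rs) ∷ AllPairs-weaken f qs rss

module Binomial where

  open import Data.Nat using (ℕ; zero; suc; _+_; _*_; _∸_; _≤_)
  open import Data.Nat.Properties
  open import Data.Nat.Combinatorics using (_C_; nCk+nC[k+1]≡[n+1]C[k+1]; nC1≡n)
  open import Data.Nat.ListAction using (sum)
  open import Data.Nat.ListAction.Properties using (sum-++)
  open import Data.Nat.Tactic.RingSolver using (solve-∀)
  open import Data.List using ([]; _∷_; _++_; map; upTo)
  open import Data.List.Properties using (upTo-∷ʳ; map-++)
  open import Relation.Binary.PropositionalEquality as ≡ using (_≡_; cong; cong₂)
  open ≡.≡-Reasoning

  pascal : ∀ n k → suc n C suc k ≡ n C k + n C suc k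
  pascal n k = ≡.sym (nCk+nC[k+1]≡[n+1]C[k+1] n k)

  absorption : ∀ n j → suc j * (suc n C suc j) ≡ suc n * (n C j)
  absorption zero    zero    = ≡.refl
  absorption zero    (suc j) = *-zeroʳ (suc (suc j))
  absorption (suc n) zero    = ≡.trans (+-identityʳ _) (≡.trans (nC1≡n (suc (suc n))) (≡.sym (*-identityʳ (suc (suc n)))))
  absorption (suc n) (suc j) = begin
    suc (suc j) * (suc (suc n) C suc (suc j))                  ≡⟨ cong (suc (suc j) *_) (pascal (suc n) (suc j)) ⟩
    suc (suc j) * (a + suc n C suc (suc j))                    ≡⟨ *-distribˡ-+ (suc (suc j)) a _ ⟩
    suc (suc j) * a + suc (suc j) * (suc n C suc (suc j))
      ≡⟨ cong₂ _+_ (*-distribʳ-+ a 1 (suc j)) (absorption n (suc j)) ⟩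
    (a + 0 + suc j * a) + suc n * (n C suc j)
      ≡⟨ cong (λ x → (a + 0 + x) + suc n * (n C suc j)) (absorption n j) ⟩
    (a + 0 + suc n * (n C j)) + suc n * (n C suc j)            ≡⟨ collect a (suc n) (n C j) (n C suc j) ⟩
    a + suc n * (n C j + n C suc j)                            ≡⟨ cong (λ x → a + suc n * x) (pascal n j) ⟨
    suc (suc n) * a                                            ∎
    where
    a = suc n C suc j
    collect : ∀ a b x y → (a + 0 + b * x) + b * y ≡ a + b * (x + y)
    collect = solve-∀

  -- At the boundary N + 1 = c (j + 1) the ballot number C(N, j+1) − (c−1) C(N, j) vanishes.
  ballot-boundary : ∀ c N j → 1 ≤ c → suc N ≡ c * suc j → N C suc j ≡ (c ∸ 1) * (N C j)
  ballot-boundary c N j 1≤c N+1≡c[j+1] = *-cancelˡ-≡ _ _ (suc j) (+-cancelʳ-≡ (suc j * (N C j)) _ _ (begin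
    suc j * (N C suc j) + suc j * (N C j)  ≡⟨ +-comm _ (suc j * (N C j)) ⟩
    suc j * (N C j) + suc j * (N C suc j)  ≡⟨ *-distribˡ-+ (suc j) (N C j) (N C suc j) ⟨
    suc j * (N C j + N C suc j)            ≡⟨ cong (suc j *_) (pascal N j) ⟨
    suc j * (suc N C suc j)                ≡⟨ absorption N j ⟩
    suc N * (N C j)                        ≡⟨ cong (_* (N C j)) (≡.trans N+1≡c[j+1] (cong (_* suc j) c≡1+c′)) ⟩
    suc c′ * suc j * (N C j)               ≡⟨ expand c′ j (N C j) ⟩
    suc j * (c′ * (N C j)) + suc j * (N C j) ∎))
    where
    c′ = c ∸ 1
    c≡1+c′ : c ≡ suc c′
    c≡1+c′ = ≡.sym (m+[n∸m]≡n 1≤c)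
    expand : ∀ a b x → suc a * suc b * x ≡ suc b * (a * x) + suc b * x
    expand = solve-∀

  partialSum : ℕ → ℕ → ℕ
  partialSum p k = sum (map (λ j → p C j) (upTo k))

  partialSum-suc : ∀ p k → partialSum p (suc k) ≡ partialSum p k + p C k
  partialSum-suc p k = begin
    sum (map (p C_) (upTo (suc k)))           ≡⟨ cong (λ js → sum (map (p C_) js)) (upTo-∷ʳ k) ⟨
    sum (map (p C_) (upTo k ++ k ∷ []))       ≡⟨ cong sum (map-++ (p C_) (upTo k) (k ∷ [])) ⟩
    sum (map (p C_) (upTo k) ++ p C k ∷ [])   ≡⟨ sum-++ (map (p C_) (upTo k)) (p C k ∷ []) ⟩
    partialSum p k + (p C k + 0)              ≡⟨ cong (partialSum p k +_) (+-identityʳ (p C k)) ⟩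
    partialSum p k + p C k                    ∎

  partialSum-pascal : ∀ p k → partialSum (suc p) (suc k) ≡ partialSum p (suc k) + partialSum p k
  partialSum-pascal p zero    = ≡.refl
  partialSum-pascal p (suc k) = begin
    partialSum (suc p) (suc (suc k))                                ≡⟨ partialSum-suc (suc p) (suc k) ⟩
    partialSum (suc p) (suc k) + suc p C suc k                      ≡⟨ cong₂ _+_ (partialSum-pascal p k) (pascal p k) ⟩
    (partialSum p (suc k) + partialSum p k) + (p C k + p C suc k)
      ≡⟨ regroup (partialSum p (suc k)) (partialSum p k) (p C k) (p C suc k) ⟩
    (partialSum p (suc k) + p C suc k) + (partialSum p k + p C k)
      ≡⟨ cong₂ _+_ (partialSum-suc p (suc k)) (partialSum-suc p k) ⟨
    partialSum p (suc (suc k)) + partialSum p (suc k)               ∎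
    where
    regroup : ∀ a b x y → (a + b) + (x + y) ≡ (a + y) + (b + x)
    regroup = solve-∀

module Counting (c m k : ℕ) where

  open Binomial
  open Representatives c m k using (ballotLists; bitLists; highLists; toHigh; lowBound; block; representatives)
  open import Data.Nat as ℕ using (ℕ; zero; suc; _+_; _*_; _∸_; _≤_; _<_; _^_; _≤?_; s≤s; z≤n)
  import Data.Nat.Properties as ℕₚ
  open import Data.Nat.Combinatorics using (_C_)
  open import Data.Nat.ListAction using (sum)
  open import Data.Nat.ListAction.Properties using (sum-++)
  open import Data.Integer as ℤ using (ℤ; +_)
  import Data.Integer.Properties as ℤₚ
  open import Data.Integer.Tactic.RingSolver using (solve-∀)
  open import Data.List using (List; []; _∷_; _++_; map; upTo; applyUpTo; concat; cartesianProduct; length)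
  open import Data.List.Properties using (applyUpTo-∷ʳ; length-++; length-map; map-upTo; map-∘)
  open import Data.Product using (_,_)
  open import Relation.Nullary using (yes; no; contradiction)
  open import Relation.Binary.PropositionalEquality as ≡ using (_≡_; cong; cong₂)
  open ≡.≡-Reasoning

  ballotNumber : ℕ → ℕ → ℤ
  ballotNumber N zero    = + 1
  ballotNumber N (suc j) = + (N C suc j) ℤ.- (+ c ℤ.- + 1) ℤ.* + (N C j)

  ballotNumber-pascal : ∀ N j → ballotNumber (suc N) (suc j) ≡ ballotNumber N (suc j) ℤ.+ ballotNumber N j
  ballotNumber-pascal N zero    = ≡.trans
      (cong (λ x → + x ℤ.- (+ c ℤ.- + 1) ℤ.* + 1) (≡.trans (pascal N 0) (ℕₚ.+-comm 1 (N C 1))))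
                                          (shift (+ (N C 1)) (+ c))
    where
    shift : ∀ (x d : ℤ) → (x ℤ.+ + 1) ℤ.- (d ℤ.- + 1) ℤ.* + 1 ≡ (x ℤ.- (d ℤ.- + 1) ℤ.* + 1) ℤ.+ + 1
    shift = solve-∀
  ballotNumber-pascal N (suc j) = ≡.trans (cong₂ (λ a b → + a ℤ.- (+ c ℤ.- + 1) ℤ.* + b) (pascal N (suc j)) (pascal N j))
                                          (regroup (+ (N C j)) (+ (N C suc j)) (+ (N C suc (suc j))) (+ c))
    where
    regroup : ∀ (a b d e : ℤ) →
        (b ℤ.+ d) ℤ.- (e ℤ.- + 1) ℤ.* (a ℤ.+ b) ≡ (d ℤ.- (e ℤ.- + 1) ℤ.* b) ℤ.+ (b ℤ.- (e ℤ.- + 1) ℤ.* a)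
    regroup = solve-∀

  ballotLists-empty : ∀ N j → suc N ≤ c * suc j → ballotLists N (suc j) ≡ []
  ballotLists-empty zero    j _ = ≡.refl
  ballotLists-empty (suc N) j N+1<c[j+1] with c * suc j ≤? suc N
  ... | yes c[j+1]≤N+1 = contradiction c[j+1]≤N+1 (ℕₚ.<⇒≱ N+1<c[j+1])
  ... | no  _          = ballotLists-empty N j (ℕₚ.≤-trans (ℕₚ.n≤1+n _) N+1<c[j+1])

  length-ballotLists : 1 ≤ c → ∀ N j → c * j ≤ suc N → + length (ballotLists N j) ≡ ballotNumber N j
  length-ballotLists 1≤c N       zero          _ = ≡.refl
  length-ballotLists 1≤c zero    (suc zero)    c≤1 rewrite ℕₚ.≤-antisym (≡.subst (_≤ 1) (ℕₚ.*-identityʳ c) c≤1) 1≤c = ≡.refl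
  length-ballotLists 1≤c zero    (suc (suc j)) c[j+2]≤1 =
    contradiction c[j+2]≤1 (ℕₚ.<⇒≱ (ℕₚ.≤-trans (s≤s (s≤s z≤n)) (ℕₚ.*-monoˡ-≤ (suc (suc j)) 1≤c)))
  length-ballotLists 1≤c (suc N) (suc j) c[j+1]≤N+2 with c * suc j ≤? suc N
  ... | yes c[j+1]≤N+1 = begin
    + length (ballotLists N (suc j) ++ map (suc N ∷_) (ballotLists N j))
      ≡⟨ cong +_ (≡.trans (length-++ (ballotLists N (suc j)))
        (cong (length (ballotLists N (suc j)) ℕ.+_) (length-map (suc N ∷_) (ballotLists N j)))) ⟩
    + length (ballotLists N (suc j)) ℤ.+ + length (ballotLists N j)
      ≡⟨ cong₂ ℤ._+_ (length-ballotLists 1≤c N (suc j) c[j+1]≤N+1)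
        (length-ballotLists 1≤c N j (ℕₚ.≤-trans (ℕₚ.*-monoʳ-≤ c (ℕₚ.n≤1+n j)) c[j+1]≤N+1)) ⟩
    ballotNumber N (suc j) ℤ.+ ballotNumber N j
      ≡⟨ ballotNumber-pascal N j ⟨
    ballotNumber (suc N) (suc j) ∎
  ... | no  c[j+1]≰N+1 = begin
    + length (ballotLists N (suc j))
      ≡⟨ cong (λ l → + length l) (ballotLists-empty N j (ℕₚ.≤-trans (ℕₚ.n≤1+n _) N+1<c[j+1])) ⟩
    + 0                                    ≡⟨ ℤₚ.+-inverseʳ ((+ c ℤ.- + 1) ℤ.* + x) ⟨
    (+ c ℤ.- + 1) ℤ.* + x ℤ.- (+ c ℤ.- + 1) ℤ.* + x
      ≡⟨ cong (ℤ._- (+ c ℤ.- + 1) ℤ.* + x)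
        (≡.trans (cong (ℤ._* + x) (≡.trans (ℤₚ.m-n≡m⊖n c 1) (ℤₚ.⊖-≥ 1≤c))) (≡.sym (ℤₚ.pos-* (c ∸ 1) x))) ⟩
    + ((c ∸ 1) * x) ℤ.- (+ c ℤ.- + 1) ℤ.* + x
      ≡⟨ cong (λ y → + y ℤ.- (+ c ℤ.- + 1) ℤ.* + x) (ballot-boundary c (suc N) j 1≤c (ℕₚ.≤-antisym N+1<c[j+1] c[j+1]≤N+2)) ⟨
    ballotNumber (suc N) (suc j) ∎
    where
    x = suc N C j
    N+1<c[j+1] : suc (suc N) ≤ c * suc j
    N+1<c[j+1] = ℕₚ.≰⇒> c[j+1]≰N+1

  sumBelow : ℕ → (ℕ → ℕ) → ℕ
  sumBelow zero    f = 0
  sumBelow (suc n) f = sumBelow n f + f n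

  sum-applyUpTo : ∀ f n → sum (applyUpTo f n) ≡ sumBelow n f
  sum-applyUpTo f zero    = ≡.refl
  sum-applyUpTo f (suc n) = begin
    sum (applyUpTo f (suc n))              ≡⟨ cong sum (applyUpTo-∷ʳ f n) ⟨
    sum (applyUpTo f n ++ f n ∷ [])        ≡⟨ sum-++ (applyUpTo f n) (f n ∷ []) ⟩
    sum (applyUpTo f n) + (f n + 0)        ≡⟨ cong₂ _+_ (sum-applyUpTo f n) (ℕₚ.+-identityʳ (f n)) ⟩
    sumBelow n f + f n                     ∎

  sumBelow-cong : ∀ n {f g} → (∀ j → j < n → f j ≡ g j) → sumBelow n f ≡ sumBelow n g
  sumBelow-cong zero    f≡g = ≡.refl
  sumBelow-cong (suc n) f≡g = cong₂ _+_ (sumBelow-cong n (λ j j<n → f≡g j (ℕₚ.m<n⇒m<1+n j<n))) (f≡g n ℕₚ.≤-refl)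

  sumBelow-2* : ∀ n f → sumBelow n (λ j → 2 * f j) ≡ 2 * sumBelow n f
  sumBelow-2* zero    f = ≡.refl
  sumBelow-2* (suc n) f = ≡.trans (cong (_+ 2 * f n) (sumBelow-2* n f)) (≡.sym (ℕₚ.*-distribˡ-+ 2 (sumBelow n f) (f n)))

  length-concat : ∀ {A : Set} (xss : List (List A)) → length (concat xss) ≡ sum (map length xss)
  length-concat []         = ≡.refl
  length-concat (xs ∷ xss) = ≡.trans (length-++ xs) (cong (length xs ℕ.+_) (length-concat xss))

  length-cartesianProduct : ∀ {A B : Set} (xs : List A) (ys : List B) →
      length (cartesianProduct xs ys) ≡ length xs * length ys
  length-cartesianProduct []       ys = ≡.refl
  length-cartesianProduct (x ∷ xs) ys =
    ≡.trans (length-++ (map (x ,_) ys)) (cong₂ _+_ (length-map (x ,_) ys) (length-cartesianProduct xs ys))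

  lowCount : ℕ → ℕ
  lowCount j = length (ballotLists (lowBound j) j)

  highCount : ℕ → ℕ
  highCount r = length (highLists r)

  length-bitLists : ∀ r → length (bitLists r) ≡ 2 ^ r
  length-bitLists zero    = ≡.refl
  length-bitLists (suc r) = begin
    length (map (0 ∷_) (bitLists r) ++ map (1 ∷_) (bitLists r))          ≡⟨ length-++ (map (0 ∷_) (bitLists r)) ⟩
    length (map (0 ∷_) (bitLists r)) + length (map (1 ∷_) (bitLists r))
      ≡⟨ cong₂ _+_ (length-map _ (bitLists r)) (length-map _ (bitLists r)) ⟩
    length (bitLists r) + length (bitLists r)                            ≡⟨ cong (λ n → n + n) (length-bitLists r) ⟩
    2 ^ r + 2 ^ r                                                        ≡⟨ cong (λ n → 2 ^ r + n) (ℕₚ.+-identityʳ (2 ^ r)) ⟨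
    2 ^ r + (2 ^ r + 0)                                                  ∎

  highCount-suc : ∀ r → highCount (suc r) ≡ 2 ^ r
  highCount-suc r = ≡.trans (length-map toHigh (bitLists r)) (length-bitLists r)

  doubling : ℕ → ℕ
  doubling zero    = 0
  doubling (suc i) = 2 * doubling i + lowCount i

  sumBelow-doubling : ∀ i → sumBelow i (λ j → lowCount j * 2 ^ (i ∸ suc j)) ≡ doubling i
  sumBelow-doubling zero    = ≡.refl
  sumBelow-doubling (suc i) = begin
    sumBelow i (λ j → lowCount j * 2 ^ (i ∸ j)) + lowCount i * 2 ^ (i ∸ i)
      ≡⟨ cong₂ _+_ (sumBelow-cong i twice) (≡.trans (cong (λ e → lowCount i * 2 ^ e) (ℕₚ.n∸n≡0 i)) (ℕₚ.*-identityʳ _)) ⟩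
    sumBelow i (λ j → 2 * (lowCount j * 2 ^ (i ∸ suc j))) + lowCount i
      ≡⟨ cong (_+ lowCount i) (≡.trans (sumBelow-2* i _) (cong (2 *_) (sumBelow-doubling i))) ⟩
    2 * doubling i + lowCount i ∎
    where
    twice : ∀ j → j < i → lowCount j * 2 ^ (i ∸ j) ≡ 2 * (lowCount j * 2 ^ (i ∸ suc j))
    twice j j<i = ≡.trans (cong (λ e → lowCount j * 2 ^ e) (ℕₚ.+-∸-assoc 1 j<i))
                          (≡.trans (≡.sym (ℕₚ.*-assoc (lowCount j) 2 _))
                              (≡.trans (cong (_* 2 ^ (i ∸ suc j)) (ℕₚ.*-comm (lowCount j) 2))
                                  (ℕₚ.*-assoc 2 (lowCount j) _)))

  length-representatives-doubling : length representatives ≡ doubling k + lowCount k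
  length-representatives-doubling = begin
    length (concat (map block (upTo (suc k))))          ≡⟨ length-concat (map block (upTo (suc k))) ⟩
    sum (map length (map block (upTo (suc k))))
      ≡⟨ cong sum (≡.trans (≡.sym (map-∘ (upTo (suc k)))) (map-upTo _ (suc k))) ⟩
    sum (applyUpTo (λ j → length (block j)) (suc k))   ≡⟨ sum-applyUpTo _ (suc k) ⟩
    sumBelow (suc k) (λ j → length (block j))
      ≡⟨ sumBelow-cong (suc k)
        (λ j _ → length-cartesianProduct (ballotLists (lowBound j) j) (highLists (k ∸ j))) ⟩
    sumBelow k (λ j → lowCount j * highCount (k ∸ j)) + lowCount k * highCount (k ∸ k)
      ≡⟨ cong₂ _+_ (sumBelow-cong k
        (λ j j<k → ≡.trans (cong (λ r → lowCount j * highCount r) (ℕₚ.+-∸-assoc 1 j<k))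
            (cong (lowCount j *_) (highCount-suc (k ∸ suc j)))))
                   (≡.trans (cong (λ r → lowCount k * highCount r) (ℕₚ.n∸n≡0 k)) (ℕₚ.*-identityʳ _)) ⟩
    sumBelow k (λ j → lowCount j * 2 ^ (k ∸ suc j)) + lowCount k
      ≡⟨ cong (_+ lowCount k) (sumBelow-doubling k) ⟩
    doubling k + lowCount k ∎

  m′ : ℕ
  m′ = m ∸ k

  closedForm : ℕ → ℤ
  closedForm i = + ((m′ + i ∸ 1) C i) ℤ.- (+ c ℤ.- + 2) ℤ.* + partialSum (m′ + i ∸ 1) i

  m′+[1+i]∸1 : ∀ i → m′ + suc i ∸ 1 ≡ m′ + i
  m′+[1+i]∸1 i = cong (_∸ 1) (ℕₚ.+-suc m′ i)

  lowCount-closed : 1 ≤ c → ∀ i → (c ∸ 1) * i ≤ m′ → + lowCount i ≡ ballotNumber (m′ + i ∸ 1) i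
  lowCount-closed 1≤c zero    _ = ≡.refl
  lowCount-closed 1≤c (suc i) [c-1][1+i]≤m′ = length-ballotLists 1≤c (m′ + suc i ∸ 1) (suc i)
    (ℕₚ.≤-trans (ℕₚ.≤-reflexive (cong (_* suc i) (≡.sym (ℕₚ.m+[n∸m]≡n 1≤c))))
      (ℕₚ.≤-trans (ℕₚ.+-monoʳ-≤ (suc i) [c-1][1+i]≤m′)
        (ℕₚ.≤-reflexive (≡.trans (ℕₚ.+-comm (suc i) m′) (≡.trans (ℕₚ.+-suc m′ i) (cong suc (≡.sym (m′+[1+i]∸1 i))))))))

  closedForm-step : ∀ i → + 2 ℤ.* closedForm i ℤ.- ballotNumber (m′ + i ∸ 1) i ℤ.+ ballotNumber (m′ + i)
      (suc i) ≡ closedForm (suc i)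
  closedForm-step zero    = ≡.trans (first (+ ((m′ + 0) C 1)) (+ c))
                                    (cong (λ p → + (p C 1) ℤ.- (+ c ℤ.- + 2) ℤ.* + partialSum p 1) (≡.sym (m′+[1+i]∸1 0)))
    where
    first : ∀ (y e : ℤ) → + 2 ℤ.* (+ 1 ℤ.- (e ℤ.- + 2) ℤ.* + 0) ℤ.- + 1 ℤ.+ (y ℤ.- (e ℤ.- + 1) ℤ.* + 1) ≡ y ℤ.-
        (e ℤ.- + 2) ℤ.* + 1
    first = solve-∀
  closedForm-step (suc i) = begin
    + 2 ℤ.* closedForm (suc i) ℤ.- ballotNumber (m′ + suc i ∸ 1) (suc i) ℤ.+ ballotNumber (m′ + suc i) (suc (suc i))
      ≡⟨ cong₂ (λ p q → + 2 ℤ.* (+ (p C suc i) ℤ.- (+ c ℤ.- + 2) ℤ.* + partialSum p (suc i)) ℤ.- ballotNumber p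
        (suc i) ℤ.+ ballotNumber q (suc (suc i)))
               (m′+[1+i]∸1 i) (ℕₚ.+-suc m′ i) ⟩
    + 2 ℤ.* (+ (P C suc i) ℤ.- (+ c ℤ.- + 2) ℤ.* + partialSum P (suc i)) ℤ.- ballotNumber P (suc i) ℤ.+
        ballotNumber (suc P) (suc (suc i))
      ≡⟨ cong (λ b → + 2 ℤ.* (+ (P C suc i) ℤ.- (+ c ℤ.- + 2) ℤ.* + partialSum P (suc i)) ℤ.- ballotNumber P (suc i) ℤ.+ b)
              (cong₂ (λ x y → + x ℤ.- (+ c ℤ.- + 1) ℤ.* + y) (pascal P (suc i)) (pascal P i)) ⟩
    + 2 ℤ.* (+ (P C suc i) ℤ.- (+ c ℤ.- + 2) ℤ.* + partialSum P (suc i)) ℤ.- ballotNumber P (suc i)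
      ℤ.+ ((+ (P C suc i) ℤ.+ + (P C suc (suc i))) ℤ.- (+ c ℤ.- + 1) ℤ.* (+ (P C i) ℤ.+ + (P C suc i)))
      ≡⟨ collect (+ (P C i)) (+ (P C suc i)) (+ (P C suc (suc i))) (+ partialSum P (suc i)) (+ c) ⟩
    (+ (P C suc i) ℤ.+ + (P C suc (suc i))) ℤ.- (+ c ℤ.- + 2) ℤ.*
        ((+ partialSum P (suc i) ℤ.+ + (P C suc i)) ℤ.+ + partialSum P (suc i))
      ≡⟨ cong₂ (λ x y → x ℤ.- (+ c ℤ.- + 2) ℤ.* y) (≡.sym (cong +_ (pascal P (suc i))))
               (≡.sym (cong +_ (≡.trans (partialSum-pascal P (suc i))
                   (cong (ℕ._+ partialSum P (suc i)) (partialSum-suc P (suc i)))))) ⟩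
    + (suc P C suc (suc i)) ℤ.- (+ c ℤ.- + 2) ℤ.* + partialSum (suc P) (suc (suc i))
      ≡⟨ cong (λ p → + (p C suc (suc i)) ℤ.- (+ c ℤ.- + 2) ℤ.* + partialSum p (suc (suc i)))
        (≡.sym (≡.trans (m′+[1+i]∸1 (suc i)) (ℕₚ.+-suc m′ i))) ⟩
    closedForm (suc (suc i)) ∎
    where
    P = m′ + i
    collect : ∀ (a b d s e : ℤ) →
      + 2 ℤ.* (b ℤ.- (e ℤ.- + 2) ℤ.* s) ℤ.- (b ℤ.- (e ℤ.- + 1) ℤ.* a) ℤ.+ ((b ℤ.+ d) ℤ.- (e ℤ.- + 1) ℤ.* (a ℤ.+ b))
      ≡ (b ℤ.+ d) ℤ.- (e ℤ.- + 2) ℤ.* ((s ℤ.+ b) ℤ.+ s)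
    collect = solve-∀

  doubling-closed : 1 ≤ c → ∀ i → (c ∸ 1) * i ≤ m′ → + (doubling i + lowCount i) ≡ closedForm i
  doubling-closed 1≤c zero    _ = cong (λ x → + 1 ℤ.- x) (≡.sym (ℤₚ.*-zeroʳ (+ c ℤ.- + 2)))
  doubling-closed 1≤c (suc i) [c-1][1+i]≤m′ = begin
    + (2 * doubling i + lowCount i + lowCount (suc i))
      ≡⟨ unfold (doubling i) (lowCount i) (lowCount (suc i)) ⟩
    + 2 ℤ.* (+ doubling i ℤ.+ + lowCount i) ℤ.- + lowCount i ℤ.+ + lowCount (suc i)
      ≡⟨ cong₂ (λ t x → + 2 ℤ.* t ℤ.- x ℤ.+ + lowCount (suc i)) (doubling-closed 1≤c i [c-1]i≤m′)
        (lowCount-closed 1≤c i [c-1]i≤m′) ⟩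
    + 2 ℤ.* closedForm i ℤ.- ballotNumber (m′ + i ∸ 1) i ℤ.+ + lowCount (suc i)
      ≡⟨ cong (λ x → + 2 ℤ.* closedForm i ℤ.- ballotNumber (m′ + i ∸ 1) i ℤ.+ x)
              (≡.trans (lowCount-closed 1≤c (suc i) [c-1][1+i]≤m′) (cong (λ p → ballotNumber p (suc i)) (m′+[1+i]∸1 i))) ⟩
    + 2 ℤ.* closedForm i ℤ.- ballotNumber (m′ + i ∸ 1) i ℤ.+ ballotNumber (m′ + i) (suc i)
      ≡⟨ closedForm-step i ⟩
    closedForm (suc i) ∎
    where
    [c-1]i≤m′ : (c ∸ 1) * i ≤ m′
    [c-1]i≤m′ = ℕₚ.≤-trans (ℕₚ.*-monoʳ-≤ (c ∸ 1) (ℕₚ.n≤1+n i)) [c-1][1+i]≤m′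
    unfold : ∀ (q x₀ x₁ : ℕ) → + (2 * q + x₀ + x₁) ≡ + 2 ℤ.* (+ q ℤ.+ + x₀) ℤ.- + x₀ ℤ.+ + x₁
    unfold q x₀ x₁ = ≡.trans (cong (λ z → z ℤ.+ + x₀ ℤ.+ + x₁) (ℤₚ.pos-* 2 q)) (regroup (+ q) (+ x₀) (+ x₁))
      where
      regroup : ∀ (q x₀ x₁ : ℤ) → + 2 ℤ.* q ℤ.+ x₀ ℤ.+ x₁ ≡ + 2 ℤ.* (q ℤ.+ x₀) ℤ.- x₀ ℤ.+ x₁
      regroup = solve-∀

  length-representatives : 1 ≤ c → c * k ≤ m →
      + length representatives ≡ + ((m ∸ 1) C k) ℤ.- (+ c ℤ.- + 2) ℤ.* + partialSum (m ∸ 1) k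
  length-representatives 1≤c ck≤m = begin
    + length representatives         ≡⟨ cong +_ length-representatives-doubling ⟩
    + (doubling k + lowCount k)      ≡⟨ doubling-closed 1≤c k [c-1]k≤m′ ⟩
    closedForm k
      ≡⟨ cong (λ p → + ((p ∸ 1) C k) ℤ.- (+ c ℤ.- + 2) ℤ.* + partialSum (p ∸ 1) k) (ℕₚ.m∸n+n≡m k≤m) ⟩
    + ((m ∸ 1) C k) ℤ.- (+ c ℤ.- + 2) ℤ.* + partialSum (m ∸ 1) k ∎
    where
    k≤m : k ≤ m
    k≤m = ℕₚ.≤-trans (ℕₚ.m≤n*m k c {{ℕ.>-nonZero 1≤c}}) ck≤m
    [c-1]k≤m′ : (c ∸ 1) * k ≤ m′
    [c-1]k≤m′ = ≡.subst (_≤ m′)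
        (≡.trans (cong (λ x → x * k ∸ k) (≡.sym (ℕₚ.m+[n∸m]≡n 1≤c)))
            (ℕₚ.m+n∸m≡n k ((c ∸ 1) * k))) (ℕₚ.∸-monoˡ-≤ k ck≤m)

module Classification {a ℓ} (F : Field a ℓ) (char0 : CharZero F) (c m k : ℕ) where

  open Words
  open Representatives c m k
  open Covering c m k using (covered)
  open Distinctness c m k using (distinct-multiplicity; unique-representatives; AllPairs-weaken)
  open NormalOrdering F using (weylEquiv-rook)
  open RookSymmetry using (rook-↭)
  open Separation F char0 using (weylEquiv⇒multiplicity≡)
  open import Data.Nat using (_≤_; _*_)
  open import Data.List.Relation.Unary.All as All using (All)
  open import Data.List.Relation.Unary.AllPairs using (AllPairs)
  open import Data.List.Relation.Unary.Any as Any using (Any)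
  open import Data.List.Relation.Binary.Permutation.Propositional using (_↭_; ↭-sym)
  open import Data.Product using (∃; _×_; _,_)
  open import Relation.Nullary using (¬_)
  open import Relation.Binary.PropositionalEquality as ≡ using (_≡_; _≢_)

  module _ (1≤c : 1 ≤ c) (ck≤m : c * k ≤ m) where

    representatives-admissible :
      All (λ p → InM c (representative p) × #D (representative p) ≡ k × #U (representative p) ≡ m) representatives
    representatives-admissible = All.tabulate λ {p} p∈ → let j , v = ∈representatives⇒Valid p∈ in
      InM-representative 1≤c ck≤m j p v , #D-representative 1≤c ck≤m j p v , #U-representative 1≤c ck≤m j p v

    representatives-inequivalent : AllPairs (λ p q → ¬ WeylEquiv F (representative p) (representative q)) representatives
    representatives-inequivalent = AllPairs-weaken inequivalent (All.tabulate ∈representatives⇒Valid) unique-representatives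
      where
      inequivalent : ∀ {p q} → (∃ λ j → Valid j p) → (∃ λ j → Valid j q) → p ≢ q →
                     ¬ WeylEquiv F (representative p) (representative q)
      inequivalent {p} {q} (j , v) (j′ , v′) p≢q p≈q with distinct-multiplicity 1≤c (k≤m 1≤c ck≤m) v v′ p≢q
      ... | t , differ = differ (≡.subst₂ (λ xs ys → multiplicity t xs ≡ multiplicity t ys)
                                  (levels-representative 1≤c ck≤m j p v) (levels-representative 1≤c ck≤m j′ q v′)
                                  (weylEquiv⇒multiplicity≡ {representative p} {representative q} #U≡#U p≈q t))
        where
        #U≡#U = ≡.trans (#U-representative 1≤c ck≤m j p v) (≡.sym (#U-representative 1≤c ck≤m j′ q v′))

    representatives-cover : ∀ w → InM c w → #D w ≡ k → #U w ≡ m →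
                            Any (λ p → WeylEquiv F w (representative p)) representatives
    representatives-cover w inM #Dw≡k #Uw≡m with covered 1≤c ck≤m w inM #Dw≡k #Uw≡m
    ... | j , p , v , arrangement↭levels = Any.map (λ { ≡.refl → w≈p }) (Valid⇒∈representatives 1≤c j p v)
      where
      #U≡#U = ≡.trans #Uw≡m (≡.sym (#U-representative 1≤c ck≤m j p v))
      #D≡#D = ≡.trans #Dw≡k (≡.sym (#D-representative 1≤c ck≤m j p v))
      levels↭levels : levels w ↭ levels (representative p)
      levels↭levels = ≡.subst (levels w ↭_) (≡.sym (levels-representative 1≤c ck≤m j p v)) (↭-sym arrangement↭levels)
      w≈p : WeylEquiv F w (representative p)
      w≈p = weylEquiv-rook w (representative p) #U≡#U #D≡#D (rook-↭ w (representative p) #U≡#U levels↭levels)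


open import Data.Nat using (ℕ; _≤_; _*_; _+_; _∸_)
open import Data.Integer using (+_)
open import Relation.Binary.PropositionalEquality using (_≡_)
open import Data.Product using (∃; _×_; _,_)
open import Level using (Level)
open import Data.Nat.Properties using (m+n≤o⇒m≤o∸n; *-distribʳ-+; *-identityˡ)
open import Data.List using (map; length)
open import Data.List.Properties using (length-map)
import Data.List.Relation.Unary.All.Properties as All
import Data.List.Relation.Unary.AllPairs.Properties as AllPairs
import Data.List.Relation.Unary.Any.Properties as Any
open import Relation.Binary.PropositionalEquality using (subst; trans; cong)

theorem6p11 : ∀ {a ℓ : Level} (F : Field a ℓ) → CharZero F →
    (c n k : ℕ) → 1 ≤ c → 1 ≤ n → 1 ≤ k → (c + 1) * k ≤ n →
    ∃ λ (N : ℕ) → a-is F c n k N × + N ≡ rhs c n k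
theorem6p11 F char0 c n k 1≤c _ _ [c+1]k≤n =
  length representatives ,
  ( map representative representatives
  , length-map representative representatives
  , All.map⁺ (representatives-admissible 1≤c ck≤m)
  , AllPairs.map⁺ (representatives-inequivalent 1≤c ck≤m)
  , λ w (inM , #Dw≡k , #Uw≡m) → Any.map⁺ (representatives-cover 1≤c ck≤m w inM #Dw≡k #Uw≡m) ) ,
  Counting.length-representatives c m k 1≤c ck≤m
  where
  m = n ∸ k
  ck≤m : c * k ≤ m
  ck≤m = m+n≤o⇒m≤o∸n (c * k) (subst (_≤ n) (trans (*-distribʳ-+ k c 1) (cong (λ x → c * k + x) (*-identityˡ k)))
                                          [c+1]k≤n)
  open Representatives c m k using (representatives; representative)
  open Classification F char0 c m k
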